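{- Let $\mathbb{C}$ be a strict Markov category and $\theta\colon\mathrm{Var}\to\mathrm{ob}(\mathbb{C})$. Two $\mathbb{C}_\theta$-kernels $f$ and $g$ satisfy $f\sqsubseteq g$ if and only if there exist a finite set of variables $U$ and a $\mathbb{C}_\theta$-kernel $h$ such that $g=(f\oplus\mathrm{id}_{[U]})\odot h$ (with both compositions defined), where $\mathrm{id}_{[U]}$ is viewed as a kernel $U\to U$.
   Context: $\mathrm{Var}$ is a countably infinite set with a strict linear order $\prec$; $[S]$ is the $\prec$-increasing list of finite $S\subseteq\mathrm{Var}$. A strict Markov category is a strict symmetric monoidal category where each object $A$ has $\mathsf{copy}_A\colon A\to A\otimes A$, $\mathsf{del}_A\colon A\to\mathsf I$ forming a commutative comonoid compatible with $\otimes$, with $\mathsf{del}$ natural. $\mathbb{C}_\theta$: objects finite lists of variables; morphisms $[x_1..x_m]\to[y_1..y_n]$ are $\mathbb{C}$-morphisms $\theta(x_1)\otimes\cdots\otimes\theta(x_m)\to\theta(y_1)\otimes\cdots\otimes\theta(y_n)$; composition, identities, copy, delete, $\otimes$ (concatenation on objects) from $\mathbb{C}$. Rewirings are symmetry-built permutations of factors according to a permutation of variables. A $\mathbb{C}_\theta$-kernel $f\colon X\to Y$ ($X\subseteq Y$ finite) is a morphism $[X]\to[Y]$ equal to $\sigma\circ(\mathrm{id}_{[X]}\otimes f')\circ\mathsf{copy}_{[X]}$ for some $f'\colon[X]\to[Y\setminus X]$ (nontrivial part) and rewiring $\sigma$. Sequential composition: $f\odot g=g\circ f$, defined iff codomain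 of $f$ = domain of $g$. For kernels $f\colon X\to Y$, $g\colon U\to V$ with nontrivial parts $f',g'$: $f\oplus g$ is defined iff $X\cap U=Y\cap V$ and equals $\sigma_2\circ(\mathrm{id}_{L_1LL_2}\otimes(f'\circ\rho_1)\otimes(g'\circ\rho_2))\circ(\mathrm{id}_{L_1LL_2}\otimes\mathrm{id}_{L_1}\otimes\mathsf{copy}_L\otimes\mathrm{id}_{L_2})\circ\mathsf{copy}_{L_1LL_2}\circ\sigma_1$, where $L=[X\cap U]$, $L_1=[X\setminus U]$, $L_2=[U\setminus X]$ and $\sigma_1,\rho_1,\rho_2,\sigma_2$ are the rewirings $[X\cup U]\to L_1LL_2$, $L_1L\to[X]$, $LL_2\to[U]$, $L_1LL_2[Y\setminus X][V\setminus U]\to[Y\cup V]$. Subkernel: for kernels $f\colon X\to Y$ and $g$, $f\sqsubseteq g$ iff there exist a finite set $Z$ of variables not in $Y$, a kernel $h$, and rewirings $\sigma_1\colon[X\cup Z]\to[X][Z]$, $\sigma_2\colon[Y][Z]\to[Y\cup Z]$ with $g=h\circ\sigma_2\circ(f\otimes\mathrm{id}_{[Z]})\circ\sigma_1$. -}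

module Defs where

open import Level using (Level; _⊔_; suc)
open import Data.Nat using (ℕ)
open import Data.Product using (Σ; ∃; _×_; _,_)
open import Data.List using (List; []; _∷_; _++_; filter)
open import Data.List.Properties using (++-assoc)
open import Data.List.Relation.Unary.Linked using (Linked)
open import Data.List.Relation.Binary.Permutation.Propositional using (_↭_)
import Data.List.Relation.Binary.Permutation.Propositional as Perm
open import Data.List.Relation.Binary.Subset.Propositional using (_⊆_)
open import Data.List.Membership.Propositional using (_∈_; _∉_)
import Data.List.Membership.DecPropositional as DecMem
open import Relation.Nullary using (¬?)
open import Relation.Binary using (Rel; IsStrictTotalOrder; tri<; tri≈; tri>)
open import Relation.Binary.PropositionalEquality using (_≡_; refl; sym; trans; cong; subst₂)
open import Function.Bundles using (_⤖_)

record VarStructure : Set₁ where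
  field
    Var        : Set
    _≺_        : Rel Var Level.zero
    isSTO      : IsStrictTotalOrder _≡_ _≺_
    countable  : Var ⤖ ℕ

record StrictMarkov (o ℓ : Level) : Set (suc (o ⊔ ℓ)) where
  infixr 9 _∘_
  infixr 10 _⊗₀_ _⊗₁_
  field
    Obj : Set o
    Hom : Obj → Obj → Set ℓ
    Obj-isSet : ∀ {A B : Obj} (p q : A ≡ B) → p ≡ q

    id  : ∀ {A} → Hom A A
    _∘_ : ∀ {A B C} → Hom B C → Hom A B → Hom A C
    identityˡ : ∀ {A B} {f : Hom A B} → id ∘ f ≡ f
    identityʳ : ∀ {A B} {f : Hom A B} → f ∘ id ≡ f
    assoc     : ∀ {A B C D} {f : Hom A B} {g : Hom B C} {h : Hom C D} →
                (h ∘ g) ∘ f ≡ h ∘ (g ∘ f)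

    I    : Obj
    _⊗₀_ : Obj → Obj → Obj
    _⊗₁_ : ∀ {A B C D} → Hom A B → Hom C D → Hom (A ⊗₀ C) (B ⊗₀ D)
    ⊗-id : ∀ {A B} → id {A} ⊗₁ id {B} ≡ id
    ⊗-∘  : ∀ {A B C D E F} {f : Hom B C} {g : Hom A B} {h : Hom E F} {k : Hom D E} →
           (f ∘ g) ⊗₁ (h ∘ k) ≡ (f ⊗₁ h) ∘ (g ⊗₁ k)
    assoc₀  : ∀ {A B C} → (A ⊗₀ B) ⊗₀ C ≡ A ⊗₀ (B ⊗₀ C)
    unitˡ₀  : ∀ {A} → I ⊗₀ A ≡ A
    unitʳ₀  : ∀ {A} → A ⊗₀ I ≡ A
    assoc₁  : ∀ {A B C D E F} {f : Hom A B} {g : Hom C D} {h : Hom E F} →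
              subst₂ Hom assoc₀ assoc₀ ((f ⊗₁ g) ⊗₁ h) ≡ f ⊗₁ (g ⊗₁ h)
    unitˡ₁  : ∀ {A B} {f : Hom A B} → subst₂ Hom unitˡ₀ unitˡ₀ (id {I} ⊗₁ f) ≡ f
    unitʳ₁  : ∀ {A B} {f : Hom A B} → subst₂ Hom unitʳ₀ unitʳ₀ (f ⊗₁ id {I}) ≡ f

    σ : ∀ {A B} → Hom (A ⊗₀ B) (B ⊗₀ A)
    σ-natural : ∀ {A B C D} {f : Hom A B} {g : Hom C D} →
                σ ∘ (f ⊗₁ g) ≡ (g ⊗₁ f) ∘ σ
    σ-involutive : ∀ {A B} → σ {B} {A} ∘ σ {A} {B} ≡ id
    σ-hexagon : ∀ {A B C} →
      σ {A} {B ⊗₀ C} ≡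
      subst₂ Hom assoc₀ (sym assoc₀)
        ((id {B} ⊗₁ σ {A} {C}) ∘ subst₂ Hom refl assoc₀ (σ {A} {B} ⊗₁ id {C}))
    σ-unit : ∀ {A} → σ {A} {I} ≡ subst₂ Hom (sym unitʳ₀) (sym unitˡ₀) (id {A})

    copy : ∀ {A} → Hom A (A ⊗₀ A)
    del  : ∀ {A} → Hom A I
    counitˡ : ∀ {A} → subst₂ Hom refl unitˡ₀ ((del ⊗₁ id) ∘ copy {A}) ≡ id
    counitʳ : ∀ {A} → subst₂ Hom refl unitʳ₀ ((id ⊗₁ del) ∘ copy {A}) ≡ id
    coassoc : ∀ {A} → subst₂ Hom refl assoc₀ ((copy ⊗₁ id) ∘ copy {A}) ≡ (id ⊗₁ copy) ∘ copy {A}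
    cocomm  : ∀ {A} → σ ∘ copy {A} ≡ copy {A}
    copy-⊗ : ∀ {A B} →
      copy {A ⊗₀ B} ≡
      subst₂ Hom (trans (cong (A ⊗₀_) assoc₀) (sym assoc₀))
                 (trans (cong (A ⊗₀_) assoc₀) (sym assoc₀))
             (id {A} ⊗₁ (σ {A} {B} ⊗₁ id {B}))
      ∘ (copy {A} ⊗₁ copy {B})
    copy-I : copy {I} ≡ subst₂ Hom refl (sym unitˡ₀) (id {I})
    del-⊗  : ∀ {A B} → del {A ⊗₀ B} ≡ subst₂ Hom refl unitˡ₀ (del {A} ⊗₁ del {B})
    del-I  : del {I} ≡ id
    del-natural : ∀ {A B} {f : Hom A B} → del ∘ f ≡ del

module Theory {o ℓ : Level} (V : VarStructure) (C : StrictMarkov o ℓ)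
              (θ : VarStructure.Var V → StrictMarkov.Obj C) where

  open VarStructure V public
  open StrictMarkov C public
  open IsStrictTotalOrder isSTO using (compare; _≟_)
  open DecMem _≟_ using (_∈?_)

  -- finite sets of variables are represented by their ≺-increasing
  -- listing [S]; `Sorted S` says a list is such a listing.
  Sorted : List Var → Set
  Sorted = Linked _≺_

  _∩_ : List Var → List Var → List Var
  X ∩ U = filter (λ x → x ∈? U) X

  _∖_ : List Var → List Var → List Var
  X ∖ U = filter (λ x → ¬? (x ∈? U)) X

  _∪_ : List Var → List Var → List Var
  [] ∪ ys = ys
  (x ∷ xs) ∪ ys = go ys
    where
      go : List Var → List Var
      go [] = x ∷ xs
      go (y ∷ ys') with compare x y
      ... | tri< _ _ _ = x ∷ (xs ∪ (y ∷ ys'))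
      ... | tri≈ _ _ _ = x ∷ (xs ∪ ys')
      ... | tri> _ _ _ = y ∷ go ys'

  -- objects of C_θ are lists of variables; θ(x₁) ⊗ ⋯ ⊗ θ(xₘ)
  ⟦_⟧ : List Var → Obj
  ⟦ [] ⟧ = I
  ⟦ x ∷ xs ⟧ = θ x ⊗₀ ⟦ xs ⟧

  ⟦++⟧ : ∀ xs ys → ⟦ xs ++ ys ⟧ ≡ ⟦ xs ⟧ ⊗₀ ⟦ ys ⟧
  ⟦++⟧ [] ys = sym unitˡ₀
  ⟦++⟧ (x ∷ xs) ys = trans (cong (θ x ⊗₀_) (⟦++⟧ xs ys)) (sym assoc₀)

  -- morphisms of C_θ: a morphism [x₁..xₘ] → [y₁..yₙ] is a C-morphism
  -- θ(x₁)⊗⋯⊗θ(xₘ) → θ(y₁)⊗⋯⊗θ(yₙ) (wrapped in a record so that the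
  -- lists are recoverable from the type)
  record Hθ (xs ys : List Var) : Set ℓ where
    constructor ⌜_⌝
    field ⌞_⌟ : Hom ⟦ xs ⟧ ⟦ ys ⟧
  open Hθ public

  infixr 9 _∘θ_
  _∘θ_ : ∀ {xs ys zs} → Hθ ys zs → Hθ xs ys → Hθ xs zs
  ⌜ g ⌝ ∘θ ⌜ f ⌝ = ⌜ g ∘ f ⌝

  castθ : ∀ {xs xs' ys ys'} → xs ≡ xs' → ys ≡ ys' → Hθ xs ys → Hθ xs' ys'
  castθ refl refl f = f

  idθ : ∀ xs → Hθ xs xs
  idθ xs = ⌜ id ⌝

  infixr 10 _⊗θ_
  _⊗θ_ : ∀ {xs ys us vs} → Hθ xs ys → Hθ us vs → Hθ (xs ++ us) (ys ++ vs)
  _⊗θ_ {xs} {ys} {us} {vs} ⌜ f ⌝ ⌜ g ⌝ =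
    ⌜ subst₂ Hom (sym (⟦++⟧ xs us)) (sym (⟦++⟧ ys vs)) (f ⊗₁ g) ⌝

  copyθ : ∀ xs → Hθ xs (xs ++ xs)
  copyθ xs = ⌜ subst₂ Hom refl (sym (⟦++⟧ xs xs)) copy ⌝

  rw₀ : ∀ {xs ys} → xs ↭ ys → Hom ⟦ xs ⟧ ⟦ ys ⟧
  rw₀ Perm.refl = id
  rw₀ (Perm.prep x p) = id {θ x} ⊗₁ rw₀ p
  rw₀ (Perm.swap x y p) = subst₂ Hom assoc₀ assoc₀ (σ {θ x} {θ y} ⊗₁ rw₀ p)
  rw₀ (Perm.trans p q) = rw₀ q ∘ rw₀ p

  rw : ∀ {xs ys} → xs ↭ ys → Hθ xs ys
  rw p = ⌜ rw₀ p ⌝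

  IsNontrivialPart : ∀ {X Y} → Hθ X Y → Hθ X (Y ∖ X) → Set ℓ
  IsNontrivialPart {X} {Y} f f' =
    Σ ((X ++ (Y ∖ X)) ↭ Y) λ s → f ≡ rw s ∘θ (idθ X ⊗θ f') ∘θ copyθ X

  IsKernel : (X Y : List Var) → Hθ X Y → Set ℓ
  IsKernel X Y f = Sorted X × Sorted Y × X ⊆ Y × Σ (Hθ X (Y ∖ X)) (IsNontrivialPart f)

  Kernel : List Var → List Var → Set ℓ
  Kernel X Y = Σ (Hθ X Y) (IsKernel X Y)

  -- k = f ⊕ g (for f : X → Y, g : U → V kernels), including the
  -- definedness condition X ∩ U = Y ∩ V.
  IsOplus : ∀ {X Y U V} → Hθ X Y → Hθ U V → Hθ (X ∪ U) (Y ∪ V) → Set ℓ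
  IsOplus {X} {Y} {U} {V} f g k =
    (X ∩ U ≡ Y ∩ V) ×
    Σ (Hθ X (Y ∖ X)) λ f' → IsNontrivialPart f f' ×
    Σ (Hθ U (V ∖ U)) λ g' → IsNontrivialPart g g' ×
    Σ ((X ∪ U) ↭ (L₁ ++ L ++ L₂)) λ σ₁ →
    Σ ((L₁ ++ L) ↭ X) λ ρ₁ →
    Σ ((L ++ L₂) ↭ U) λ ρ₂ →
    Σ (((L₁ ++ L ++ L₂) ++ ((Y ∖ X) ++ (V ∖ U))) ↭ (Y ∪ V)) λ σ₂ →
      k ≡ rw σ₂
        ∘θ (idθ (L₁ ++ L ++ L₂) ⊗θ ((f' ∘θ rw ρ₁) ⊗θ (g' ∘θ rw ρ₂)))
        ∘θ (idθ (L₁ ++ L ++ L₂) ⊗θ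
             castθ refl (mid L₁ L L₂) (idθ L₁ ⊗θ (copyθ L ⊗θ idθ L₂)))
        ∘θ copyθ (L₁ ++ L ++ L₂)
        ∘θ rw σ₁
    where
      L  = X ∩ U
      L₁ = X ∖ U
      L₂ = U ∖ X
      mid : ∀ (a b c : List Var) → a ++ ((b ++ b) ++ c) ≡ (a ++ b) ++ (b ++ c)
      mid a b c = trans (cong (a ++_) (++-assoc b b c)) (sym (++-assoc a b (b ++ c)))

  _⊑_ : ∀ {X Y X' Y'} → Kernel X Y → Kernel X' Y' → Set ℓ
  _⊑_ {X} {Y} {X'} {Y'} (f , _) (g , _) =
    Σ (List Var) λ Z → Sorted Z × (∀ z → z ∈ Z → z ∉ Y) ×
    Σ (X ∪ Z ≡ X') λ e →
    Σ (Kernel (Y ∪ Z) Y') λ h →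
    Σ ((X ∪ Z) ↭ (X ++ Z)) λ σ₁ →
    Σ ((Y ++ Z) ↭ (Y ∪ Z)) λ σ₂ →
      g ≡ castθ e refl (proj₁' h ∘θ rw σ₂ ∘θ (f ⊗θ idθ Z) ∘θ rw σ₁)
    where
      proj₁' : ∀ {A B} → Kernel A B → Hθ A B
      proj₁' (m , _) = m

-- f ⊕ id_U copies L = X ∩ U and feeds one copy to f and the other, together with U ∖ X, to
-- the nontrivial part of id_U. That part lands in the unit, so it is the discard map, and by
-- the counit law the extra copy of L disappears: f ⊕ id_U is f ⊗ id_{U ∖ X} up to rewiring
-- (copy naturality of rewirings moves the input rewiring of the formula past the copy). Hence
-- g = h ∘ (f ⊕ id_U) exhibits f ⊑ g with Z = U ∖ X, which misses Y because X ∩ U = Y ∩ U.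
-- Conversely, if Z misses Y then X ∩ Z = Y ∩ Z = ∅, and the same computation shows that
-- f ⊗ id_Z between the rewirings of f ⊑ g is f ⊕ id_Z, once the output rewiring of the
-- formula is chosen to cancel the one the computation produces.
module Submission where

open import Defs
open import Level using (Level; _⊔_)
open import Data.Product using (Σ; _×_; _,_; proj₁; proj₂)
open import Data.Empty using (⊥-elim)
open import Data.List using (List; []; _∷_; _++_)
open import Data.List.Properties using (++-identityʳ; ++-assoc; filter-all; filter-none)
open import Data.List.Relation.Unary.All as All using (All)
import Data.List.Relation.Unary.All.Properties as All
open import Data.List.Relation.Unary.Any using (here; there)
import Data.List.Relation.Unary.Linked as Linked
import Data.List.Relation.Unary.Linked.Properties as Linked
open import Data.List.Membership.Propositional using (_∈_; _∉_)
open import Data.List.Membership.Propositional.Properties using (∈-filter⁻; ∈-filter⁺)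
import Data.List.Membership.DecPropositional as DecMembership
open import Data.List.Relation.Binary.Permutation.Propositional using (_↭_; ↭-reflexive; ↭-sym)
import Data.List.Relation.Binary.Permutation.Propositional as Perm
open import Data.List.Relation.Binary.Permutation.Propositional.Properties using (++⁺ˡ; ++⁺ʳ)
open import Relation.Nullary using (yes; no; ¬?)
open import Relation.Binary using (IsStrictTotalOrder; tri<; tri≈; tri>)
open import Relation.Binary.PropositionalEquality
  using (_≡_; refl; sym; trans; cong; cong₂; subst; subst₂; module ≡-Reasoning)
open import Function.Bundles using (_⇔_; mk⇔)

module Markov {o ℓ : Level} (C : StrictMarkov o ℓ) where
  open StrictMarkov C

  infix 4 _≅_
  data _≅_ {A B : Obj} (f : Hom A B) : {A' B' : Obj} → Hom A' B' → Set (o ⊔ ℓ) where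
    ≅-refl : f ≅ f

  module _ {A B A' B' A'' B'' : Obj} {f : Hom A B} {g : Hom A' B'} {h : Hom A'' B''} where
    ≅-trans : f ≅ g → g ≅ h → f ≅ h
    ≅-trans ≅-refl q = q

  ≅-sym : ∀ {A B A' B'} {f : Hom A B} {g : Hom A' B'} → f ≅ g → g ≅ f
  ≅-sym ≅-refl = ≅-refl

  ≡⇒≅ : ∀ {A B} {f g : Hom A B} → f ≡ g → f ≅ g
  ≡⇒≅ refl = ≅-refl

  ≅⇒≡ : ∀ {A B} {f g : Hom A B} → f ≅ g → f ≡ g
  ≅⇒≡ ≅-refl = refl

  ≅-dom : ∀ {A B A' B'} {f : Hom A B} {g : Hom A' B'} → f ≅ g → A ≡ A'
  ≅-dom ≅-refl = refl

  subst₂≅ : ∀ {A B A' B'} (p : A ≡ A') (q : B ≡ B') (f : Hom A B) → subst₂ Hom p q f ≅ f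
  subst₂≅ refl refl f = ≅-refl

  ∘≅ : ∀ {A B C A' B' C'} {f : Hom A B} {g : Hom B C} {f' : Hom A' B'} {g' : Hom B' C'} →
       g ≅ g' → f ≅ f' → (g ∘ f) ≅ (g' ∘ f')
  ∘≅ ≅-refl ≅-refl = ≅-refl

  ⊗≅ : ∀ {A B C D A' B' C' D'} {f : Hom A B} {g : Hom C D} {f' : Hom A' B'} {g' : Hom C' D'} →
       f ≅ f' → g ≅ g' → (f ⊗₁ g) ≅ (f' ⊗₁ g')
  ⊗≅ ≅-refl ≅-refl = ≅-refl

  id≅ : ∀ {A A'} → A ≡ A' → id {A} ≅ id {A'}
  id≅ refl = ≅-refl

  σ≅ : ∀ {A A' B B'} → A ≡ A' → B ≡ B' → σ {A} {B} ≅ σ {A'} {B'}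
  σ≅ refl refl = ≅-refl

  copy≅ : ∀ {A A'} → A ≡ A' → copy {A} ≅ copy {A'}
  copy≅ refl = ≅-refl

  del≅ : ∀ {A A'} → A ≡ A' → del {A} ≅ del {A'}
  del≅ refl = ≅-refl

  module ≅-Reasoning where
    infix  3 _∎
    infixr 2 _≅⟨_⟩_ _≡⟨_⟩_ _≅˘⟨_⟩_
    infix 1 begin_

    begin_ : ∀ {A B A' B'} {f : Hom A B} {g : Hom A' B'} → f ≅ g → f ≅ g
    begin p = p

    _≅⟨_⟩_ : ∀ {A B A' B' A'' B''} (f : Hom A B) {g : Hom A' B'} {h : Hom A'' B''} →
             f ≅ g → g ≅ h → f ≅ h
    f ≅⟨ p ⟩ q = ≅-trans p q

    _≅˘⟨_⟩_ : ∀ {A B A' B' A'' B''} (f : Hom A B) {g : Hom A' B'} {h : Hom A'' B''} →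
              g ≅ f → g ≅ h → f ≅ h
    f ≅˘⟨ p ⟩ q = ≅-trans (≅-sym p) q

    _≡⟨_⟩_ : ∀ {A B A'' B''} (f : Hom A B) {g : Hom A B} {h : Hom A'' B''} →
             f ≡ g → g ≅ h → f ≅ h
    f ≡⟨ p ⟩ q = ≅-trans (≡⇒≅ p) q

    _∎ : ∀ {A B} (f : Hom A B) → f ≅ f
    f ∎ = ≅-refl

  assoc≅ : ∀ {A B C D E F} {f : Hom A B} {g : Hom C D} {h : Hom E F} →
           ((f ⊗₁ g) ⊗₁ h) ≅ (f ⊗₁ (g ⊗₁ h))
  assoc≅ = ≅-trans (≅-sym (subst₂≅ assoc₀ assoc₀ _)) (≡⇒≅ assoc₁)

  unitˡ≅ : ∀ {A B} {f : Hom A B} → (id {I} ⊗₁ f) ≅ f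
  unitˡ≅ = ≅-trans (≅-sym (subst₂≅ unitˡ₀ unitˡ₀ _)) (≡⇒≅ unitˡ₁)

  unitʳ≅ : ∀ {A B} {f : Hom A B} → (f ⊗₁ id {I}) ≅ f
  unitʳ≅ = ≅-trans (≅-sym (subst₂≅ unitʳ₀ unitʳ₀ _)) (≡⇒≅ unitʳ₁)

  ⊗-∘≅ : ∀ {A B C D E F} {f : Hom B C} {g : Hom A B} {h : Hom E F} {k : Hom D E} →
         ((f ∘ g) ⊗₁ (h ∘ k)) ≅ ((f ⊗₁ h) ∘ (g ⊗₁ k))
  ⊗-∘≅ = ≡⇒≅ ⊗-∘

  ⊗-id≅ : ∀ {A B} → (id {A} ⊗₁ id {B}) ≅ id {A ⊗₀ B}
  ⊗-id≅ = ≡⇒≅ ⊗-id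

  counitʳ≅ : ∀ {A} → ((id {A} ⊗₁ del {A}) ∘ copy) ≅ id {A}
  counitʳ≅ = ≅-trans (≅-sym (subst₂≅ refl unitʳ₀ _)) (≡⇒≅ counitʳ)

  id-retype : ∀ {A B A'} {i : Hom A B} → i ≅ id {A'} → i ≅ id {A}
  id-retype p = ≅-trans p (id≅ (sym (≅-dom p)))

  absorbʳ : ∀ {A B C A' B' A''} {g : Hom B C} {i : Hom A B} {g' : Hom A' B'} →
            i ≅ id {A''} → g ≅ g' → (g ∘ i) ≅ g'
  absorbʳ p q with id-retype p
  ... | ≅-refl = ≅-trans (≡⇒≅ identityʳ) q

  absorbˡ : ∀ {A B C A' B' B''} {f : Hom A B} {i : Hom B C} {f' : Hom A' B'} →
            i ≅ id {B''} → f ≅ f' → (i ∘ f) ≅ f'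
  absorbˡ p q with id-retype p
  ... | ≅-refl = ≅-trans (≡⇒≅ identityˡ) q

  σ-unitʳ≅ : ∀ {A} → σ {A} {I} ≅ id {A}
  σ-unitʳ≅ = ≅-trans (≡⇒≅ σ-unit) (subst₂≅ _ _ _)

  σ-unitˡ≅ : ∀ {A} → σ {I} {A} ≅ id {A}
  σ-unitˡ≅ {A} = ≅-trans (cancel (≅-trans σ-unitʳ≅ (id≅ (sym unitʳ₀))) (≡⇒≅ σ-involutive)) (id≅ unitˡ₀)
    where
      cancel : ∀ {A B C} {f : Hom A B} {g : Hom B C} → g ≅ id {B} → (g ∘ f) ≅ id {A} → f ≅ id {A}
      cancel ≅-refl q = ≅-trans (≡⇒≅ (sym identityˡ)) q

  into-I≅del : ∀ {A B} (h : Hom A B) → B ≡ I → h ≅ del {A}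
  into-I≅del h refl = ≡⇒≅ (trans (sym identityˡ) (trans (cong (_∘ h) (sym del-I)) del-natural))

  -- Morphisms between lists of objects, ⊕ concatenating the lists. The operations are opaque
  -- and used only through the un-lemmas, which keeps their transports out of the way.
  ⟦_⟧w : List Obj → Obj
  ⟦ [] ⟧w = I
  ⟦ A ∷ xs ⟧w = A ⊗₀ ⟦ xs ⟧w

  ⟦++⟧w : ∀ xs ys → ⟦ xs ++ ys ⟧w ≡ ⟦ xs ⟧w ⊗₀ ⟦ ys ⟧w
  ⟦++⟧w [] ys = sym unitˡ₀
  ⟦++⟧w (x ∷ xs) ys = trans (cong (x ⊗₀_) (⟦++⟧w xs ys)) (sym assoc₀)

  record HomL (xs ys : List Obj) : Set ℓ where
    constructor mk
    field un : Hom ⟦ xs ⟧w ⟦ ys ⟧w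
  open HomL public

  infixr 9 _·_
  infixr 10 _⊕_
  opaque
    _·_ : ∀ {xs ys zs} → HomL ys zs → HomL xs ys → HomL xs zs
    g · f = mk (un g ∘ un f)

    idL : ∀ xs → HomL xs xs
    idL xs = mk id

    _⊕_ : ∀ {xs ys us vs} → HomL xs ys → HomL us vs → HomL (xs ++ us) (ys ++ vs)
    _⊕_ {xs} {ys} {us} {vs} f g =
      mk (subst₂ Hom (sym (⟦++⟧w xs us)) (sym (⟦++⟧w ys vs)) (un f ⊗₁ un g))

    ⟨_⟩ : ∀ {A B} → Hom A B → HomL (A ∷ []) (B ∷ [])
    ⟨ f ⟩ = mk (subst₂ Hom (sym unitʳ₀) (sym unitʳ₀) f)

    σL : ∀ xs ys → HomL (xs ++ ys) (ys ++ xs)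
    σL xs ys = mk (subst₂ Hom (sym (⟦++⟧w xs ys)) (sym (⟦++⟧w ys xs)) (σ {⟦ xs ⟧w} {⟦ ys ⟧w}))

    copyL : ∀ xs → HomL xs (xs ++ xs)
    copyL xs = mk (subst₂ Hom refl (sym (⟦++⟧w xs xs)) copy)

    delL : ∀ xs → HomL xs []
    delL xs = mk del

    coerceL : ∀ {xs ys} → ⟦ xs ⟧w ≡ ⟦ ys ⟧w → HomL xs ys
    coerceL p = mk (subst₂ Hom refl p id)

    un· : ∀ {xs ys zs} (g : HomL ys zs) (f : HomL xs ys) → un (g · f) ≅ (un g ∘ un f)
    un· g f = ≅-refl

    unid : ∀ xs → un (idL xs) ≅ id {⟦ xs ⟧w}
    unid xs = ≅-refl

    un⊕ : ∀ {xs ys us vs} (f : HomL xs ys) (g : HomL us vs) → un (f ⊕ g) ≅ (un f ⊗₁ un g)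
    un⊕ f g = subst₂≅ _ _ _

    un⟨⟩ : ∀ {A B} (f : Hom A B) → un ⟨ f ⟩ ≅ f
    un⟨⟩ f = subst₂≅ _ _ _

    unσ : ∀ xs ys → un (σL xs ys) ≅ σ {⟦ xs ⟧w} {⟦ ys ⟧w}
    unσ xs ys = subst₂≅ _ _ _

    uncopy : ∀ xs → un (copyL xs) ≅ copy {⟦ xs ⟧w}
    uncopy xs = subst₂≅ _ _ _

    undel : ∀ xs → un (delL xs) ≅ del {⟦ xs ⟧w}
    undel xs = ≅-refl

    uncoerce : ∀ {xs ys} (p : ⟦ xs ⟧w ≡ ⟦ ys ⟧w) → un (coerceL {xs} {ys} p) ≅ id {⟦ xs ⟧w}
    uncoerce p = subst₂≅ refl p id

  HomL-ext : ∀ {xs ys} {f g : HomL xs ys} → un f ≅ un g → f ≡ g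
  HomL-ext {f = mk f} {mk g} p with ≅⇒≡ p
  ... | refl = refl

  HomL-ext-id : ∀ {xs ys} (f g : HomL xs ys) {A B : Obj} → un f ≅ id {A} → un g ≅ id {B} → f ≡ g
  HomL-ext-id f g p q = HomL-ext (≅-trans (id-retype p) (≅-sym (id-retype q)))

  ·≅ : ∀ {xs ys zs A B C} {g : HomL ys zs} {f : HomL xs ys} {G : Hom B C} {F : Hom A B} →
       un g ≅ G → un f ≅ F → un (g · f) ≅ (G ∘ F)
  ·≅ {g = g} {f} p q = ≅-trans (un· g f) (∘≅ p q)

  ⊕≅ : ∀ {xs ys zs ws xs' ys' zs' ws'} {g : HomL xs ys} {f : HomL zs ws}
         {g' : HomL xs' ys'} {f' : HomL zs' ws'} →
       un g ≅ un g' → un f ≅ un f' → un (g ⊕ f) ≅ un (g' ⊕ f')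
  ⊕≅ {g = g} {f} {g'} {f'} p q = ≅-trans (un⊕ g f) (≅-trans (⊗≅ p q) (≅-sym (un⊕ g' f')))

  ·-assoc : ∀ {a b c d} {f : HomL a b} {g : HomL b c} {h : HomL c d} → (h · g) · f ≡ h · (g · f)
  ·-assoc {f = f} {g} {h} = HomL-ext (≅-trans (·≅ (un· h g) ≅-refl)
    (≅-trans (≡⇒≅ assoc) (≅-sym (·≅ ≅-refl (un· g f)))))

  ·-identityˡ : ∀ {a b} {f : HomL a b} → idL b · f ≡ f
  ·-identityˡ {b = b} = HomL-ext (≅-trans (·≅ (unid b) ≅-refl) (≡⇒≅ identityˡ))

  ·-identityʳ : ∀ {a b} {f : HomL a b} → f · idL a ≡ f
  ·-identityʳ {a} = HomL-ext (≅-trans (·≅ ≅-refl (unid a)) (≡⇒≅ identityʳ))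

  ⊕-· : ∀ {a b c d e g} {f : HomL b c} {f' : HomL a b} {h : HomL e g} {h' : HomL d e} →
        (f · f') ⊕ (h · h') ≡ (f ⊕ h) · (f' ⊕ h')
  ⊕-· {f = f} {f'} {h} {h'} = HomL-ext
    (≅-trans (un⊕ (f · f') (h · h')) (≅-trans (⊗≅ (un· f f') (un· h h'))
      (≅-trans ⊗-∘≅ (≅-sym (·≅ (un⊕ f h) (un⊕ f' h'))))))

  ⊕-id : ∀ a b → idL a ⊕ idL b ≡ idL (a ++ b)
  ⊕-id a b = HomL-ext (≅-trans (un⊕ (idL a) (idL b)) (≅-trans (⊗≅ (unid a) (unid b))
    (≅-trans ⊗-id≅ (≅-trans (id≅ (sym (⟦++⟧w a b))) (≅-sym (unid (a ++ b)))))))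

  ⊕-assoc≅ : ∀ {a b c d e g} (f : HomL a b) (h : HomL c d) (k : HomL e g) →
             un ((f ⊕ h) ⊕ k) ≅ un (f ⊕ (h ⊕ k))
  ⊕-assoc≅ f h k = ≅-trans (un⊕ (f ⊕ h) k) (≅-trans (⊗≅ (un⊕ f h) ≅-refl)
    (≅-trans assoc≅ (≅-sym (≅-trans (un⊕ f (h ⊕ k)) (⊗≅ ≅-refl (un⊕ h k))))))

  ⊕-identityʳ≅ : ∀ {a b} (f : HomL a b) → un (f ⊕ idL []) ≅ un f
  ⊕-identityʳ≅ f = ≅-trans (un⊕ f (idL [])) (≅-trans (⊗≅ ≅-refl (unid [])) unitʳ≅)

  σL-natural : ∀ {xs ys us vs} (f : HomL xs ys) (g : HomL us vs) →
               σL ys vs · (f ⊕ g) ≡ (g ⊕ f) · σL xs us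
  σL-natural {xs} {ys} {us} {vs} f g = HomL-ext (≅-trans (·≅ (unσ ys vs) (un⊕ f g))
    (≅-trans (≡⇒≅ σ-natural) (≅-sym (·≅ (un⊕ g f) (unσ xs us)))))

  σL-involutive : ∀ xs ys → σL ys xs · σL xs ys ≡ idL (xs ++ ys)
  σL-involutive xs ys = HomL-ext (≅-trans (·≅ (unσ ys xs) (unσ xs ys))
    (≅-trans (≡⇒≅ σ-involutive) (≅-trans (id≅ (sym (⟦++⟧w xs ys))) (≅-sym (unid (xs ++ ys))))))

  counitL : ∀ xs → un ((idL xs ⊕ delL xs) · copyL xs) ≅ id {⟦ xs ⟧w}
  counitL xs = ≅-trans (·≅ (≅-trans (un⊕ (idL xs) (delL xs)) (⊗≅ (unid xs) (undel xs))) (uncopy xs))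
    counitʳ≅

  ⊕-splitˡ : ∀ {a b c d} (f : HomL a b) (g : HomL c d) → f ⊕ g ≡ (f ⊕ idL d) · (idL a ⊕ g)
  ⊕-splitˡ f g = trans (cong₂ _⊕_ (sym ·-identityʳ) (sym ·-identityˡ)) ⊕-·

  ⊕-splitʳ : ∀ {a b c d} (f : HomL a b) (g : HomL c d) → f ⊕ g ≡ (idL b ⊕ g) · (f ⊕ idL c)
  ⊕-splitʳ f g = trans (cong₂ _⊕_ (sym ·-identityˡ) (sym ·-identityʳ)) ⊕-·

  id⊕-· : ∀ {a b c d} (f : HomL c d) (g : HomL b c) → (idL a ⊕ f) · (idL a ⊕ g) ≡ idL a ⊕ (f · g)
  id⊕-· f g = sym (trans (cong₂ _⊕_ (sym ·-identityˡ) refl) ⊕-·)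

  id++⊕≅ : ∀ {c e} a b (g : HomL c e) → un (idL (a ++ b) ⊕ g) ≅ un (idL a ⊕ (idL b ⊕ g))
  id++⊕≅ a b g = ≅-trans (≡⇒≅ (cong (λ t → un (t ⊕ g)) (sym (⊕-id a b)))) (⊕-assoc≅ (idL a) (idL b) g)

  interchangeL : ∀ A B → HomL (A ∷ A ∷ B ∷ B ∷ []) (A ∷ B ∷ A ∷ B ∷ [])
  interchangeL A B = idL (A ∷ []) ⊕ (σL (A ∷ []) (B ∷ []) ⊕ idL (B ∷ []))

  copy²L : ∀ A B → HomL (A ∷ B ∷ []) (A ∷ B ∷ A ∷ B ∷ [])
  copy²L A B = interchangeL A B · (copyL (A ∷ []) ⊕ copyL (B ∷ []))

  copy⊕-counitʳ : ∀ A Z → let a = A ∷ [] ; z = Z ∷ [] in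
                  (idL (a ++ a) ⊕ (idL z ⊕ delL z)) · (copyL a ⊕ copyL z) ≡ copyL a ⊕ idL z
  copy⊕-counitʳ A Z = begin
    (idL (a ++ a) ⊕ (idL z ⊕ delL z)) · (copyL a ⊕ copyL z)
      ≡⟨ cong ((idL (a ++ a) ⊕ (idL z ⊕ delL z)) ·_) (⊕-splitʳ (copyL a) (copyL z)) ⟩
    (idL (a ++ a) ⊕ (idL z ⊕ delL z)) · (idL (a ++ a) ⊕ copyL z) · (copyL a ⊕ idL z)
      ≡⟨ sym ·-assoc ⟩
    ((idL (a ++ a) ⊕ (idL z ⊕ delL z)) · (idL (a ++ a) ⊕ copyL z)) · (copyL a ⊕ idL z)
      ≡⟨ cong (_· (copyL a ⊕ idL z)) (id⊕-· _ _) ⟩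
    (idL (a ++ a) ⊕ ((idL z ⊕ delL z) · copyL z)) · (copyL a ⊕ idL z)
      ≡⟨ cong (λ t → (idL (a ++ a) ⊕ t) · (copyL a ⊕ idL z)) (HomL-ext (≅-trans (counitL z) (≅-sym (unid z)))) ⟩
    (idL (a ++ a) ⊕ idL z) · (copyL a ⊕ idL z)
      ≡⟨ cong (_· (copyL a ⊕ idL z)) (⊕-id (a ++ a) z) ⟩
    idL (a ++ a ++ z) · (copyL a ⊕ idL z)
      ≡⟨ ·-identityˡ ⟩
    copyL a ⊕ idL z ∎
    where
      open ≡-Reasoning
      a = A ∷ []
      z = Z ∷ []

  delL-⊕ : ∀ A B → un (delL (A ∷ B ∷ [])) ≅ un (delL (A ∷ []) ⊕ delL (B ∷ []))
  delL-⊕ A B = ≅-trans (undel _) (≅-trans (≡⇒≅ (del-⊗ {A} {B ⊗₀ I})) (≅-trans (subst₂≅ _ _ _)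
    (≅-sym (≅-trans (un⊕ _ _) (⊗≅ (≅-trans (undel _) (del≅ unitʳ₀)) (undel _))))))

  discard-copied : ∀ {P Q R Y} (F : HomL (P ∷ Q ∷ []) (Y ∷ [])) →
                   (F ⊕ delL (Q ∷ R ∷ [])) · (idL (P ∷ []) ⊕ (copyL (Q ∷ []) ⊕ idL (R ∷ []))) ≡ F ⊕ delL (R ∷ [])
  discard-copied {P} {Q} {R} F = begin
    (F ⊕ delL (q ++ r)) · (idL p ⊕ (copyL q ⊕ idL r))
      ≡⟨ cong₂ _·_ (trans (cong (F ⊕_) (HomL-ext (delL-⊕ Q R))) (HomL-ext (≅-sym (⊕-assoc≅ F (delL q) (delL r)))))
                   (HomL-ext (≅-sym (⊕-assoc≅ (idL p) (copyL q) (idL r)))) ⟩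
    ((F ⊕ delL q) ⊕ delL r) · ((idL p ⊕ copyL q) ⊕ idL r)
      ≡⟨ trans (sym ⊕-·) (cong₂ _⊕_ refl ·-identityʳ) ⟩
    ((F ⊕ delL q) · (idL p ⊕ copyL q)) ⊕ delL r
      ≡⟨ cong (λ t → (t · (idL p ⊕ copyL q)) ⊕ delL r)
              (trans (⊕-splitˡ F (delL q)) (cong (_· (idL (p ++ q) ⊕ delL q)) (HomL-ext (⊕-identityʳ≅ F)))) ⟩
    ((F · (idL (p ++ q) ⊕ delL q)) · (idL p ⊕ copyL q)) ⊕ delL r
      ≡⟨ cong (_⊕ delL r) (trans ·-assoc (cong (F ·_) counit-q)) ⟩
    (F · idL (p ++ q)) ⊕ delL r
      ≡⟨ cong (_⊕ delL r) ·-identityʳ ⟩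
    F ⊕ delL r ∎
    where
      open ≡-Reasoning
      p = P ∷ []
      q = Q ∷ []
      r = R ∷ []
      counit-q : (idL (p ++ q) ⊕ delL q) · (idL p ⊕ copyL q) ≡ idL (p ++ q)
      counit-q = trans (cong (_· (idL p ⊕ copyL q)) (HomL-ext (id++⊕≅ p q (delL q))))
        (trans (id⊕-· _ _) (trans (cong (idL p ⊕_) (HomL-ext (≅-trans (counitL q) (≅-sym (unid q))))) (⊕-id p q)))

  module _ {A Z D : Obj} (F : Hom A D) where
    private
      a = A ∷ []
      z = Z ∷ []
      d = D ∷ []

    apply-discard-σ : σL z d · (idL z ⊕ (⟨ F ⟩ ⊕ delL z)) · (σL a z ⊕ idL z)
                      ≡ (⟨ F ⟩ ⊕ idL z) · (idL a ⊕ (idL z ⊕ delL z))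
    apply-discard-σ = begin
      σL z d · (idL z ⊕ (⟨ F ⟩ ⊕ delL z)) · (σL a z ⊕ idL z)
        ≡⟨ cong (λ t → σL z d · t · (σL a z ⊕ idL z))
                (trans (HomL-ext (≅-sym (⊕-assoc≅ (idL z) ⟨ F ⟩ (delL z)))) (⊕-splitˡ (idL z ⊕ ⟨ F ⟩) (delL z))) ⟩
      σL z d · (((idL z ⊕ ⟨ F ⟩) ⊕ idL []) · (idL (z ++ a) ⊕ delL z)) · (σL a z ⊕ idL z)
        ≡⟨ cong (λ t → σL z d · (t · (idL (z ++ a) ⊕ delL z)) · (σL a z ⊕ idL z))
                (HomL-ext (⊕-identityʳ≅ (idL z ⊕ ⟨ F ⟩))) ⟩
      σL z d · ((idL z ⊕ ⟨ F ⟩) · (idL (z ++ a) ⊕ delL z)) · (σL a z ⊕ idL z)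
        ≡⟨ trans (cong (σL z d ·_) ·-assoc) (sym ·-assoc) ⟩
      (σL z d · (idL z ⊕ ⟨ F ⟩)) · (idL (z ++ a) ⊕ delL z) · (σL a z ⊕ idL z)
        ≡⟨ cong₂ (λ t u → t · u) (σL-natural (idL z) ⟨ F ⟩)
                 (trans (sym (⊕-splitʳ (σL a z) (delL z))) (⊕-splitˡ (σL a z) (delL z))) ⟩
      ((⟨ F ⟩ ⊕ idL z) · σL z a) · (σL a z ⊕ idL []) · (idL (a ++ z) ⊕ delL z)
        ≡⟨ cong (λ t → ((⟨ F ⟩ ⊕ idL z) · σL z a) · t · (idL (a ++ z) ⊕ delL z))
                (HomL-ext (⊕-identityʳ≅ (σL a z))) ⟩
      ((⟨ F ⟩ ⊕ idL z) · σL z a) · σL a z · (idL (a ++ z) ⊕ delL z)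
        ≡⟨ trans ·-assoc (cong ((⟨ F ⟩ ⊕ idL z) ·_) (sym ·-assoc)) ⟩
      (⟨ F ⟩ ⊕ idL z) · (σL z a · σL a z) · (idL (a ++ z) ⊕ delL z)
        ≡⟨ cong (λ t → (⟨ F ⟩ ⊕ idL z) · t · (idL (a ++ z) ⊕ delL z)) (σL-involutive a z) ⟩
      (⟨ F ⟩ ⊕ idL z) · idL (a ++ z) · (idL (a ++ z) ⊕ delL z)
        ≡⟨ cong ((⟨ F ⟩ ⊕ idL z) ·_) (trans ·-identityˡ (HomL-ext (id++⊕≅ a z (delL z)))) ⟩
      (⟨ F ⟩ ⊕ idL z) · (idL a ⊕ (idL z ⊕ delL z)) ∎
      where open ≡-Reasoning

    copy²-apply-discard : (idL a ⊕ σL z d) · (idL (a ++ z) ⊕ (⟨ F ⟩ ⊕ delL z)) · copy²L A Z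
                          ≡ ((idL a ⊕ ⟨ F ⟩) · copyL a) ⊕ idL z
    copy²-apply-discard = begin
      (idL a ⊕ σL z d) · (idL (a ++ z) ⊕ (⟨ F ⟩ ⊕ delL z)) · interchangeL A Z · copies
        ≡⟨ cong (λ t → (idL a ⊕ σL z d) · t · interchangeL A Z · copies)
                (HomL-ext (id++⊕≅ a z (⟨ F ⟩ ⊕ delL z))) ⟩
      (idL a ⊕ σL z d) · (idL a ⊕ (idL z ⊕ (⟨ F ⟩ ⊕ delL z))) · (idL a ⊕ (σL a z ⊕ idL z)) · copies
        ≡⟨ trans (cong ((idL a ⊕ σL z d) ·_) (trans (sym ·-assoc) (cong (_· copies) (id⊕-· _ _))))
                 (trans (sym ·-assoc) (cong (_· copies) (id⊕-· _ _))) ⟩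
      (idL a ⊕ (σL z d · (idL z ⊕ (⟨ F ⟩ ⊕ delL z)) · (σL a z ⊕ idL z))) · copies
        ≡⟨ cong (λ t → (idL a ⊕ t) · copies) apply-discard-σ ⟩
      (idL a ⊕ ((⟨ F ⟩ ⊕ idL z) · (idL a ⊕ (idL z ⊕ delL z)))) · copies
        ≡⟨ trans (cong (_· copies) (sym (id⊕-· _ _))) ·-assoc ⟩
      (idL a ⊕ (⟨ F ⟩ ⊕ idL z)) · (idL a ⊕ (idL a ⊕ (idL z ⊕ delL z))) · copies
        ≡⟨ cong₂ _·_ (HomL-ext (≅-sym (⊕-assoc≅ (idL a) ⟨ F ⟩ (idL z))))
                     (trans (cong (_· copies) (HomL-ext (≅-sym (id++⊕≅ a a (idL z ⊕ delL z)))))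
                            (copy⊕-counitʳ A Z)) ⟩
      ((idL a ⊕ ⟨ F ⟩) ⊕ idL z) · (copyL a ⊕ idL z)
        ≡⟨ trans (sym ⊕-·) (cong (((idL a ⊕ ⟨ F ⟩) · copyL a) ⊕_) ·-identityˡ) ⟩
      ((idL a ⊕ ⟨ F ⟩) · copyL a) ⊕ idL z ∎
      where
        open ≡-Reasoning
        copies = copyL a ⊕ copyL z

  σL-⊕ʳ≅ : ∀ xs B C →
           un (σL xs (B ∷ C ∷ [])) ≅ un ((idL (B ∷ []) ⊕ σL xs (C ∷ [])) · (σL xs (B ∷ []) ⊕ idL (C ∷ [])))
  σL-⊕ʳ≅ xs B C = ≅-trans (unσ xs (B ∷ C ∷ []))
    (≅-trans (≡⇒≅ (σ-hexagon {⟦ xs ⟧w} {B} {C ⊗₀ I})) (≅-trans (subst₂≅ _ _ _) (≅-sym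
      (·≅ (≅-trans (un⊕ _ _) (⊗≅ (≅-trans (unid _) (id≅ unitʳ₀)) (unσ xs (C ∷ []))))
          (≅-trans (un⊕ _ _) (≅-trans (⊗≅ (≅-trans (unσ xs (B ∷ [])) (σ≅ refl unitʳ₀)) (unid _))
                                      (≅-sym (subst₂≅ _ _ _))))))))

  -- The other hexagon, obtained from σL-⊕ʳ≅ by inverting both sides.
  σL-⊕ˡ : ∀ A₁ A₂ B → let a₁ = A₁ ∷ [] ; a₂ = A₂ ∷ [] ; b = B ∷ [] in
          σL (a₁ ++ a₂) b ≡ (σL a₁ b ⊕ idL a₂) · (idL a₁ ⊕ σL a₂ b)
  σL-⊕ˡ A₁ A₂ B = begin
    σL (a₁ ++ a₂) b                                  ≡⟨ sym ·-identityˡ ⟩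
    idL (b ++ a₁ ++ a₂) · σL (a₁ ++ a₂) b            ≡⟨ cong (_· σL (a₁ ++ a₂) b) (sym Q-inverse) ⟩
    (Q · σL b (a₁ ++ a₂)) · σL (a₁ ++ a₂) b          ≡⟨ ·-assoc ⟩
    Q · σL b (a₁ ++ a₂) · σL (a₁ ++ a₂) b            ≡⟨ cong (Q ·_) (σL-involutive (a₁ ++ a₂) b) ⟩
    Q · idL (a₁ ++ a₂ ++ b)                          ≡⟨ ·-identityʳ ⟩
    Q                                                ∎
    where
      open ≡-Reasoning
      a₁ = A₁ ∷ []
      a₂ = A₂ ∷ []
      b = B ∷ []
      Q = (σL a₁ b ⊕ idL a₂) · (idL a₁ ⊕ σL a₂ b)
      Q-inverse : Q · σL b (a₁ ++ a₂) ≡ idL (b ++ a₁ ++ a₂)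
      Q-inverse = begin
        Q · σL b (a₁ ++ a₂)
          ≡⟨ cong (Q ·_) (HomL-ext (σL-⊕ʳ≅ b A₁ A₂)) ⟩
        ((σL a₁ b ⊕ idL a₂) · (idL a₁ ⊕ σL a₂ b)) · ((idL a₁ ⊕ σL b a₂) · (σL b a₁ ⊕ idL a₂))
          ≡⟨ trans ·-assoc (cong ((σL a₁ b ⊕ idL a₂) ·_) (sym ·-assoc)) ⟩
        (σL a₁ b ⊕ idL a₂) · ((idL a₁ ⊕ σL a₂ b) · (idL a₁ ⊕ σL b a₂)) · (σL b a₁ ⊕ idL a₂)
          ≡⟨ cong (λ t → (σL a₁ b ⊕ idL a₂) · t · (σL b a₁ ⊕ idL a₂))
                  (trans (id⊕-· _ _) (trans (cong (idL a₁ ⊕_) (σL-involutive b a₂)) (⊕-id a₁ (b ++ a₂)))) ⟩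
        (σL a₁ b ⊕ idL a₂) · idL (a₁ ++ b ++ a₂) · (σL b a₁ ⊕ idL a₂)
          ≡⟨ trans (cong ((σL a₁ b ⊕ idL a₂) ·_) ·-identityˡ) (sym ⊕-·) ⟩
        (σL a₁ b · σL b a₁) ⊕ (idL a₂ · idL a₂)
          ≡⟨ trans (cong₂ _⊕_ (σL-involutive b a₁) ·-identityˡ) (⊕-id (b ++ a₁) a₂) ⟩
        idL (b ++ a₁ ++ a₂) ∎

  copy-⊗≅ : ∀ A B → copy {A ⊗₀ B} ≅ un (copy²L A B)
  copy-⊗≅ A B = ≅-trans (≡⇒≅ (copy-⊗ {A} {B})) (≅-trans (∘≅
    (≅-trans (subst₂≅ _ _ (id {A} ⊗₁ (σ {A} {B} ⊗₁ id {B}))) (≅-sym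
      (≅-trans (un⊕ _ _) (⊗≅ (≅-trans (unid _) (id≅ unitʳ₀))
        (≅-trans (un⊕ _ _) (⊗≅ (≅-trans (unσ _ _) (σ≅ unitʳ₀ unitʳ₀)) (≅-trans (unid _) (id≅ unitʳ₀))))))))
    (≅-sym (≅-trans (un⊕ _ _) (⊗≅ (≅-trans (uncopy (A ∷ [])) (copy≅ unitʳ₀))
                                 (≅-trans (uncopy (B ∷ [])) (copy≅ unitʳ₀)))))) (≅-sym (un· _ _)))

  copyL-pair : ∀ A B → un (copyL (A ∷ B ∷ [])) ≅ un (copy²L A B)
  copyL-pair A B = ≅-trans (uncopy (A ∷ B ∷ [])) (≅-trans (≡⇒≅ (copy-⊗ {A} {B ⊗₀ I})) (≅-sym
    (·≅ (≅-trans (un⊕ _ _) (≅-trans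
           (⊗≅ (≅-trans (unid _) (id≅ unitʳ₀))
               (≅-trans (un⊕ _ _) (⊗≅ (≅-trans (unσ _ _) (σ≅ {A ⊗₀ I} {A} {B ⊗₀ I} unitʳ₀ refl)) (unid _))))
           (≅-sym (subst₂≅ _ _ (id {A} ⊗₁ (σ {A} {B ⊗₀ I} ⊗₁ id {B ⊗₀ I}))))))
        (≅-trans (un⊕ _ _) (⊗≅ (≅-trans (uncopy (A ∷ [])) (copy≅ unitʳ₀)) (uncopy (B ∷ [])))))))

  ⟨⟩-∘ : ∀ {A B C} (g : Hom B C) (f : Hom A B) → ⟨ g ⟩ · ⟨ f ⟩ ≡ ⟨ g ∘ f ⟩
  ⟨⟩-∘ g f = HomL-ext (≅-trans (·≅ (un⟨⟩ g) (un⟨⟩ f)) (≅-sym (un⟨⟩ _)))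

  CopyNatural : ∀ {A B} → Hom A B → Set (o ⊔ ℓ)
  CopyNatural f = (copy ∘ f) ≅ ((f ⊗₁ f) ∘ copy)

  copyNatural-≅ : ∀ {A B A' B'} {f : Hom A B} {f' : Hom A' B'} → f ≅ f' → CopyNatural f → CopyNatural f'
  copyNatural-≅ ≅-refl c = c

  copyNatural-id : ∀ {A} → CopyNatural (id {A})
  copyNatural-id = ≅-trans (≡⇒≅ identityʳ) (≅-sym (≅-trans (∘≅ ⊗-id≅ ≅-refl) (≡⇒≅ identityˡ)))

  copyNatural-∘ : ∀ {A B C} {f : Hom A B} {g : Hom B C} → CopyNatural f → CopyNatural g → CopyNatural (g ∘ f)
  copyNatural-∘ {f = f} {g} cf cg = begin
    copy ∘ (g ∘ f)                ≡⟨ sym assoc ⟩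
    (copy ∘ g) ∘ f                ≅⟨ ∘≅ cg ≅-refl ⟩
    ((g ⊗₁ g) ∘ copy) ∘ f         ≡⟨ assoc ⟩
    (g ⊗₁ g) ∘ (copy ∘ f)         ≅⟨ ∘≅ ≅-refl cf ⟩
    (g ⊗₁ g) ∘ ((f ⊗₁ f) ∘ copy)  ≡⟨ trans (sym assoc) (cong (_∘ copy) (sym ⊗-∘)) ⟩
    ((g ∘ f) ⊗₁ (g ∘ f)) ∘ copy   ∎
    where open ≅-Reasoning

  copyL-natural : ∀ {A B} (f : Hom A B) → CopyNatural f →
                  copyL (B ∷ []) · ⟨ f ⟩ ≡ (⟨ f ⟩ ⊕ ⟨ f ⟩) · copyL (A ∷ [])
  copyL-natural f cf = HomL-ext (≅-trans (·≅ (≅-trans (uncopy _) (copy≅ unitʳ₀)) (un⟨⟩ f))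
    (≅-trans cf (≅-sym (·≅ (≅-trans (un⊕ _ _) (⊗≅ (un⟨⟩ f) (un⟨⟩ f))) (≅-trans (uncopy _) (copy≅ unitʳ₀))))))

  copyNatural-pair : ∀ {A C B D} {h : Hom (A ⊗₀ C) (B ⊗₀ D)} (H : HomL (A ∷ C ∷ []) (B ∷ D ∷ [])) →
                     un H ≅ h → copy²L B D · H ≡ (H ⊕ H) · copy²L A C → CopyNatural h
  copyNatural-pair {A} {C} {B} {D} {h} H H≅h eq = begin
    copy ∘ h
      ≅⟨ ∘≅ (copy-⊗≅ B D) (≅-sym H≅h) ⟩
    un (copy²L B D) ∘ un H
      ≅˘⟨ un· _ _ ⟩
    un (copy²L B D · H)
      ≡⟨ cong un eq ⟩
    un ((H ⊕ H) · copy²L A C)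
      ≅⟨ ·≅ (≅-trans (un⊕ H H) (⊗≅ H≅h H≅h)) (≅-sym (copy-⊗≅ A C)) ⟩
    (h ⊗₁ h) ∘ copy ∎
    where open ≅-Reasoning

  copyNatural-⊗ : ∀ {A B C D} {f : Hom A B} {g : Hom C D} → CopyNatural f → CopyNatural g → CopyNatural (f ⊗₁ g)
  copyNatural-⊗ {A} {B} {C} {D} {f} {g} cf cg =
    copyNatural-pair (⟨ f ⟩ ⊕ ⟨ g ⟩) (≅-trans (un⊕ _ _) (⊗≅ (un⟨⟩ f) (un⟨⟩ g))) (begin
      (interchangeL B D · (copyL b ⊕ copyL d)) · (⟨ f ⟩ ⊕ ⟨ g ⟩)
        ≡⟨ trans ·-assoc (cong (interchangeL B D ·_) (trans (sym ⊕-·)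
             (trans (cong₂ _⊕_ (copyL-natural f cf) (copyL-natural g cg)) ⊕-·))) ⟩
      interchangeL B D · ((⟨ f ⟩ ⊕ ⟨ f ⟩) ⊕ (⟨ g ⟩ ⊕ ⟨ g ⟩)) · (copyL a ⊕ copyL c)
        ≡⟨ trans (sym ·-assoc) (trans (cong (_· (copyL a ⊕ copyL c)) interchange-natural) ·-assoc) ⟩
      ((⟨ f ⟩ ⊕ ⟨ g ⟩) ⊕ (⟨ f ⟩ ⊕ ⟨ g ⟩)) · (interchangeL A C · (copyL a ⊕ copyL c)) ∎)
    where
      open ≡-Reasoning
      a = A ∷ []
      b = B ∷ []
      c = C ∷ []
      d = D ∷ []
      interchange-natural : interchangeL B D · ((⟨ f ⟩ ⊕ ⟨ f ⟩) ⊕ (⟨ g ⟩ ⊕ ⟨ g ⟩))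
                            ≡ ((⟨ f ⟩ ⊕ ⟨ g ⟩) ⊕ (⟨ f ⟩ ⊕ ⟨ g ⟩)) · interchangeL A C
      interchange-natural = begin
        (idL b ⊕ (σL b d ⊕ idL d)) · ((⟨ f ⟩ ⊕ ⟨ f ⟩) ⊕ (⟨ g ⟩ ⊕ ⟨ g ⟩))
          ≡⟨ cong ((idL b ⊕ (σL b d ⊕ idL d)) ·_) (HomL-ext (≅-trans (⊕-assoc≅ ⟨ f ⟩ ⟨ f ⟩ (⟨ g ⟩ ⊕ ⟨ g ⟩))
                (⊕≅ ≅-refl (≅-sym (⊕-assoc≅ ⟨ f ⟩ ⟨ g ⟩ ⟨ g ⟩))))) ⟩
        (idL b ⊕ (σL b d ⊕ idL d)) · (⟨ f ⟩ ⊕ ((⟨ f ⟩ ⊕ ⟨ g ⟩) ⊕ ⟨ g ⟩))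
          ≡⟨ trans (sym ⊕-·) (cong₂ _⊕_ (trans ·-identityˡ (sym ·-identityʳ)) (sym ⊕-·)) ⟩
        (⟨ f ⟩ · idL a) ⊕ ((σL b d · (⟨ f ⟩ ⊕ ⟨ g ⟩)) ⊕ (idL d · ⟨ g ⟩))
          ≡⟨ cong ((⟨ f ⟩ · idL a) ⊕_) (cong₂ _⊕_ (σL-natural ⟨ f ⟩ ⟨ g ⟩) (trans ·-identityˡ (sym ·-identityʳ))) ⟩
        (⟨ f ⟩ · idL a) ⊕ (((⟨ g ⟩ ⊕ ⟨ f ⟩) · σL a c) ⊕ (⟨ g ⟩ · idL c))
          ≡⟨ trans (cong ((⟨ f ⟩ · idL a) ⊕_) ⊕-·) ⊕-· ⟩
        (⟨ f ⟩ ⊕ ((⟨ g ⟩ ⊕ ⟨ f ⟩) ⊕ ⟨ g ⟩)) · (idL a ⊕ (σL a c ⊕ idL c))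
          ≡⟨ cong (_· (idL a ⊕ (σL a c ⊕ idL c))) (HomL-ext (≅-trans (⊕≅ ≅-refl (⊕-assoc≅ ⟨ g ⟩ ⟨ f ⟩ ⟨ g ⟩))
                (≅-sym (⊕-assoc≅ ⟨ f ⟩ ⟨ g ⟩ (⟨ f ⟩ ⊕ ⟨ g ⟩))))) ⟩
        ((⟨ f ⟩ ⊕ ⟨ g ⟩) ⊕ (⟨ f ⟩ ⊕ ⟨ g ⟩)) · interchangeL A C ∎

  copyNatural-σ : ∀ {A B} → CopyNatural (σ {A} {B})
  copyNatural-σ {A} {B} =
    copyNatural-pair (σL a b) (≅-trans (unσ a b) (σ≅ unitʳ₀ unitʳ₀)) (begin
      (interchangeL B A · (copyL b ⊕ copyL a)) · σL a b
        ≡⟨ trans ·-assoc (cong (interchangeL B A ·_) (sym (σL-natural (copyL a) (copyL b)))) ⟩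
      interchangeL B A · σL (a ++ a) (b ++ b) · (copyL a ⊕ copyL b)
        ≡⟨ trans (sym ·-assoc) (trans (cong (_· (copyL a ⊕ copyL b)) interchange-σ) ·-assoc) ⟩
      (σL a b ⊕ σL a b) · (interchangeL A B · (copyL a ⊕ copyL b)) ∎)
    where
      open ≡-Reasoning
      a = A ∷ []
      b = B ∷ []
      S = (σL a b ⊕ idL a) · (idL a ⊕ σL a b)
      σ-aabb : σL (a ++ a) (b ++ b) ≡ (idL b ⊕ S) · (S ⊕ idL b)
      σ-aabb = trans (HomL-ext (σL-⊕ʳ≅ (a ++ a) B B))
                     (cong₂ (λ t u → (idL b ⊕ t) · (u ⊕ idL b)) (σL-⊕ˡ A A B) (σL-⊕ˡ A A B))
      σba-S : (σL b a ⊕ idL a) · S ≡ idL a ⊕ σL a b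
      σba-S = trans (sym ·-assoc) (trans (cong (_· (idL a ⊕ σL a b)) (trans (sym ⊕-·)
                (trans (cong₂ _⊕_ (σL-involutive a b) ·-identityˡ) (⊕-id (a ++ b) a)))) ·-identityˡ)
      interchange-σ : interchangeL B A · σL (a ++ a) (b ++ b) ≡ (σL a b ⊕ σL a b) · interchangeL A B
      interchange-σ = begin
        interchangeL B A · σL (a ++ a) (b ++ b)
          ≡⟨ trans (cong (interchangeL B A ·_) σ-aabb) (sym ·-assoc) ⟩
        ((idL b ⊕ (σL b a ⊕ idL a)) · (idL b ⊕ S)) · (S ⊕ idL b)
          ≡⟨ cong (_· (S ⊕ idL b)) (trans (id⊕-· _ _) (cong (idL b ⊕_) σba-S)) ⟩
        (idL b ⊕ (idL a ⊕ σL a b)) · (S ⊕ idL b)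
          ≡⟨ cong ((idL b ⊕ (idL a ⊕ σL a b)) ·_) (trans (cong₂ _⊕_ refl (sym ·-identityˡ)) ⊕-·) ⟩
        (idL b ⊕ (idL a ⊕ σL a b)) · (((σL a b ⊕ idL a) ⊕ idL b) · ((idL a ⊕ σL a b) ⊕ idL b))
          ≡⟨ sym ·-assoc ⟩
        ((idL b ⊕ (idL a ⊕ σL a b)) · ((σL a b ⊕ idL a) ⊕ idL b)) · ((idL a ⊕ σL a b) ⊕ idL b)
          ≡⟨ cong₂ _·_ (trans (cong₂ _·_ (HomL-ext (≅-sym (id++⊕≅ b a (σL a b))))
                                         (trans (HomL-ext (⊕-assoc≅ (σL a b) (idL a) (idL b)))
                                                (cong (σL a b ⊕_) (⊕-id a b))))
                               (trans (sym ⊕-·) (cong₂ _⊕_ ·-identityˡ ·-identityʳ)))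
                       (HomL-ext (⊕-assoc≅ (idL a) (σL a b) (idL b))) ⟩
        (σL a b ⊕ σL a b) · interchangeL A B ∎

module Rewirings {o ℓ : Level} (V : VarStructure) (C : StrictMarkov o ℓ)
                 (θ : VarStructure.Var V → StrictMarkov.Obj C) where
  open Theory V C θ
  open Markov C

  infixl 5 _⨾_
  _⨾_ : ∀ {xs ys zs : List Var} → xs ↭ ys → ys ↭ zs → xs ↭ zs
  _⨾_ = Perm.trans

  shift↭ : ∀ (a : Var) (B A : List Var) → a ∷ (B ++ A) ↭ B ++ (a ∷ A)
  shift↭ a [] A = Perm.refl
  shift↭ a (b ∷ B) A = Perm.swap a b Perm.refl ⨾ Perm.prep b (shift↭ a B A)

  swap↭ : ∀ (A B : List Var) → A ++ B ↭ B ++ A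
  swap↭ [] B = ↭-reflexive (sym (++-identityʳ B))
  swap↭ (a ∷ A) B = Perm.prep a (swap↭ A B) ⨾ shift↭ a B A

  ⟦_⟧₁ : List Var → List Obj
  ⟦ A ⟧₁ = ⟦ A ⟧ ∷ []

  ⟦++⟧₁ : ∀ A B → ⟦ ⟦ A ++ B ⟧₁ ⟧w ≡ ⟦ ⟦ A ⟧₁ ++ ⟦ B ⟧₁ ⟧w
  ⟦++⟧₁ A B = trans unitʳ₀ (trans (⟦++⟧ A B) (cong (⟦ A ⟧ ⊗₀_) (sym unitʳ₀)))

  rw-reflexive : ∀ {xs ys : List Var} (p : xs ≡ ys) → rw₀ (↭-reflexive p) ≅ id {⟦ ys ⟧}
  rw-reflexive refl = ≅-refl

  rw-++⁺ʳ : ∀ {xs ys} zs (p : xs ↭ ys) → rw₀ (++⁺ʳ zs p) ≅ (rw₀ p ⊗₁ id {⟦ zs ⟧})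
  rw-++⁺ʳ {xs} zs Perm.refl = ≅-trans (id≅ (⟦++⟧ xs zs)) (≅-sym ⊗-id≅)
  rw-++⁺ʳ zs (Perm.prep x p) = ≅-trans (⊗≅ ≅-refl (rw-++⁺ʳ zs p)) (≅-sym assoc≅)
  rw-++⁺ʳ zs (Perm.swap x y p) = ≅-trans (subst₂≅ _ _ _) (≅-trans (⊗≅ ≅-refl (rw-++⁺ʳ zs p))
    (≅-trans (≅-sym assoc≅) (⊗≅ (≅-sym (subst₂≅ _ _ _)) ≅-refl)))
  rw-++⁺ʳ zs (Perm.trans p q) = ≅-trans (∘≅ (rw-++⁺ʳ zs q) (rw-++⁺ʳ zs p))
    (≅-trans (≅-sym ⊗-∘≅) (⊗≅ ≅-refl (≡⇒≅ identityˡ)))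

  rw-++⁺ˡ : ∀ xs {ys zs} (p : ys ↭ zs) → rw₀ (++⁺ˡ xs p) ≅ (id {⟦ xs ⟧} ⊗₁ rw₀ p)
  rw-++⁺ˡ [] p = ≅-sym unitˡ≅
  rw-++⁺ˡ (x ∷ xs) p = ≅-trans (⊗≅ ≅-refl (rw-++⁺ˡ xs p)) (≅-trans (≅-sym assoc≅) (⊗≅ ⊗-id≅ ≅-refl))

  rw-shift : ∀ a B A → rw₀ (shift↭ a B A) ≅ un (σL (θ a ∷ []) ⟦ B ⟧₁ ⊕ idL ⟦ A ⟧₁)
  rw-shift a [] A = ≅-sym (≅-trans (un⊕ _ _)
    (≅-trans (⊗≅ (≅-trans (unσ _ _) (≅-trans (σ≅ refl unitˡ₀) σ-unitʳ≅)) (unid _))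
             (≅-trans ⊗-id≅ (id≅ (cong₂ _⊗₀_ unitʳ₀ unitʳ₀)))))
  rw-shift a (b ∷ B) A = ≅-sym (begin
    un (σL a₁ (θ b ⊗₀ ⟦ B ⟧ ∷ []) ⊕ idL ⟦ A ⟧₁)
      ≅⟨ ⊕≅ (≅-trans (unσ _ _) (≅-trans (σ≅ refl (trans unitʳ₀ (cong (θ b ⊗₀_) (sym unitʳ₀))))
                                          (≅-sym (unσ _ (θ b ∷ ⟦ B ⟧ ∷ []))))) ≅-refl ⟩
    un (σL a₁ (b₁ ++ ⟦ B ⟧₁) ⊕ idL ⟦ A ⟧₁)
      ≡⟨ cong (λ t → un (t ⊕ idL ⟦ A ⟧₁)) (HomL-ext (σL-⊕ʳ≅ a₁ (θ b) ⟦ B ⟧)) ⟩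
    un (((idL b₁ ⊕ σL a₁ ⟦ B ⟧₁) · (σL a₁ b₁ ⊕ idL ⟦ B ⟧₁)) ⊕ idL ⟦ A ⟧₁)
      ≡⟨ cong un (trans (cong₂ _⊕_ refl (sym ·-identityˡ)) ⊕-·) ⟩
    un (((idL b₁ ⊕ σL a₁ ⟦ B ⟧₁) ⊕ idL ⟦ A ⟧₁) · ((σL a₁ b₁ ⊕ idL ⟦ B ⟧₁) ⊕ idL ⟦ A ⟧₁))
      ≅⟨ ·≅ (≅-trans (⊕-assoc≅ _ _ _) (≅-trans (un⊕ _ _)
                (⊗≅ (≅-trans (unid _) (id≅ unitʳ₀)) (≅-sym (rw-shift a B A)))))
            (≅-trans (⊕-assoc≅ _ _ _) (≅-trans (un⊕ _ _) (≅-trans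
              (⊗≅ (≅-trans (unσ _ _) (σ≅ unitʳ₀ unitʳ₀))
                  (≅-trans (un⊕ _ _) (≅-trans (⊗≅ (unid _) (unid _))
                    (≅-trans ⊗-id≅ (id≅ (trans (cong₂ _⊗₀_ unitʳ₀ unitʳ₀) (sym (⟦++⟧ B A))))))))
              (≅-sym (subst₂≅ _ _ _))))) ⟩
    rw₀ (shift↭ a (b ∷ B) A) ∎)
    where
      open ≅-Reasoning
      a₁ = θ a ∷ []
      b₁ = θ b ∷ []

  rw-swap : ∀ A B → rw₀ (swap↭ A B) ≅ σ {⟦ A ⟧} {⟦ B ⟧}
  rw-swap [] B = ≅-trans (rw-reflexive (sym (++-identityʳ B)))
    (≅-trans (id≅ (cong ⟦_⟧ (++-identityʳ B))) (≅-sym σ-unitˡ≅))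
  rw-swap (a ∷ A) B = begin
    rw₀ (shift↭ a B A) ∘ (id {θ a} ⊗₁ rw₀ (swap↭ A B))
      ≅⟨ ∘≅ (rw-shift a B A) (≅-sym (≅-trans (un⊕ _ _) (⊗≅ (≅-trans (unid _) (id≅ unitʳ₀))
              (≅-trans (unσ ⟦ A ⟧₁ ⟦ B ⟧₁) (≅-trans (σ≅ unitʳ₀ unitʳ₀) (≅-sym (rw-swap A B))))))) ⟩
    un (σL a₁ ⟦ B ⟧₁ ⊕ idL ⟦ A ⟧₁) ∘ un (idL a₁ ⊕ σL ⟦ A ⟧₁ ⟦ B ⟧₁)
      ≅˘⟨ un· _ _ ⟩
    un ((σL a₁ ⟦ B ⟧₁ ⊕ idL ⟦ A ⟧₁) · (idL a₁ ⊕ σL ⟦ A ⟧₁ ⟦ B ⟧₁))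
      ≡⟨ cong un (sym (σL-⊕ˡ (θ a) ⟦ A ⟧ ⟦ B ⟧)) ⟩
    un (σL (θ a ∷ ⟦ A ⟧ ∷ []) ⟦ B ⟧₁)
      ≅⟨ ≅-trans (unσ _ _) (σ≅ (cong (θ a ⊗₀_) unitʳ₀) unitʳ₀) ⟩
    σ ∎
    where
      open ≅-Reasoning
      a₁ = θ a ∷ []

  rw-inverse : ∀ {xs ys} (p : xs ↭ ys) → (rw₀ (↭-sym p) ∘ rw₀ p) ≅ id {⟦ xs ⟧}
  rw-inverse Perm.refl = ≡⇒≅ identityˡ
  rw-inverse (Perm.prep x p) = ≅-trans (≅-sym ⊗-∘≅) (≅-trans (⊗≅ (≡⇒≅ identityˡ) (rw-inverse p)) ⊗-id≅)
  rw-inverse (Perm.swap x y p) = id-retype (≅-trans (∘≅ (subst₂≅ _ _ _) (subst₂≅ _ _ _))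
    (≅-trans (≅-sym ⊗-∘≅) (≅-trans (⊗≅ (≡⇒≅ σ-involutive) (rw-inverse p)) ⊗-id≅)))
  rw-inverse (Perm.trans p q) = ≅-trans (≡⇒≅ assoc)
    (≅-trans (∘≅ ≅-refl (≅-trans (≡⇒≅ (sym assoc)) (absorbˡ (rw-inverse q) ≅-refl))) (rw-inverse p))

  copyNatural-rw : ∀ {xs ys} (p : xs ↭ ys) → CopyNatural (rw₀ p)
  copyNatural-rw Perm.refl = copyNatural-id
  copyNatural-rw (Perm.prep x p) = copyNatural-⊗ copyNatural-id (copyNatural-rw p)
  copyNatural-rw (Perm.swap x y p) =
    copyNatural-≅ (≅-sym (subst₂≅ _ _ _)) (copyNatural-⊗ copyNatural-σ (copyNatural-rw p))
  copyNatural-rw (Perm.trans p q) = copyNatural-∘ (copyNatural-rw p) (copyNatural-rw q)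

  castθ≅ : ∀ {xs xs' ys ys'} (p : xs ≡ xs') (q : ys ≡ ys') (F : Hθ xs ys) → ⌞ castθ p q F ⌟ ≅ ⌞ F ⌟
  castθ≅ refl refl F = ≅-refl

  ⊗θ≅ : ∀ {xs ys us vs} (F : Hθ xs ys) (G : Hθ us vs) → ⌞ F ⊗θ G ⌟ ≅ (⌞ F ⌟ ⊗₁ ⌞ G ⌟)
  ⊗θ≅ F G = subst₂≅ _ _ _

  copyθ≅ : ∀ xs → ⌞ copyθ xs ⌟ ≅ copy {⟦ xs ⟧}
  copyθ≅ xs = subst₂≅ _ _ _

  kernel≅ : ∀ {X D Y} (f' : Hθ X D) (s : X ++ D ↭ Y) →
            ⌞ rw s ∘θ (idθ X ⊗θ f') ∘θ copyθ X ⌟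
            ≅ un (⟨ rw₀ s ⟩ · coerceL (sym (⟦++⟧₁ X D)) · (idL ⟦ X ⟧₁ ⊕ ⟨ ⌞ f' ⌟ ⟩) · copyL ⟦ X ⟧₁)
  kernel≅ {X} f' s = ≅-sym (·≅ (un⟨⟩ _) (≅-trans (un· _ _) (absorbˡ (uncoerce _)
    (·≅ (≅-trans (un⊕ _ _) (≅-trans (⊗≅ (≅-trans (unid _) (id≅ unitʳ₀)) (un⟨⟩ _)) (≅-sym (⊗θ≅ (idθ X) f'))))
        (≅-trans (uncopy _) (≅-trans (copy≅ unitʳ₀) (≅-sym (copyθ≅ X))))))))

  ++-mid : ∀ (a b c : List Var) → a ++ ((b ++ b) ++ c) ≡ (a ++ b) ++ (b ++ c)
  ++-mid a b c = trans (cong (a ++_) (++-assoc b b c)) (sym (++-assoc a b (b ++ c)))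

  copy-middle : ∀ L₁ L L₂ → Hθ (L₁ ++ L ++ L₂) ((L₁ ++ L) ++ (L ++ L₂))
  copy-middle L₁ L L₂ = castθ refl (++-mid L₁ L L₂) (idθ L₁ ⊗θ (copyθ L ⊗θ idθ L₂))

  -- The composite in IsOplus, with L₁ = X ∖ U, L = X ∩ U and L₂ = U ∖ X abstracted.
  ⊕-formula : ∀ {A B Xs Ys D E : List Var} (L₁ L L₂ : List Var) → Hθ A D → Hθ B E →
              Xs ↭ L₁ ++ L ++ L₂ → L₁ ++ L ↭ A → L ++ L₂ ↭ B →
              (L₁ ++ L ++ L₂) ++ (D ++ E) ↭ Ys → Hθ Xs Ys
  ⊕-formula L₁ L L₂ f' g' σ₁ ρ₁ ρ₂ σ₂ =
    rw σ₂
      ∘θ (idθ (L₁ ++ L ++ L₂) ⊗θ ((f' ∘θ rw ρ₁) ⊗θ (g' ∘θ rw ρ₂)))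
      ∘θ (idθ (L₁ ++ L ++ L₂) ⊗θ copy-middle L₁ L L₂)
      ∘θ copyθ (L₁ ++ L ++ L₂)
      ∘θ rw σ₁

  discard-output≡ : ∀ L₁ L L₂ D {E : List Var} → E ≡ [] →
                    (L₁ ++ L) ++ (L₂ ++ D) ≡ (L₁ ++ L ++ L₂) ++ (D ++ E)
  discard-output≡ L₁ L L₂ D E≡[] = trans (++-assoc L₁ L (L₂ ++ D)) (trans (cong (L₁ ++_) (sym (++-assoc L L₂ D)))
    (trans (sym (++-assoc L₁ (L ++ L₂) D))
           (cong ((L₁ ++ L ++ L₂) ++_) (trans (sym (++-identityʳ D)) (cong (D ++_) (sym E≡[]))))))

  unshuffle : ∀ {A D Y E : List Var} L₁ L L₂ → A ++ D ↭ Y → L₁ ++ L ↭ A → E ≡ [] →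
              Y ++ L₂ ↭ (L₁ ++ L ++ L₂) ++ (D ++ E)
  unshuffle {A} {D} L₁ L L₂ s ρ₁ E≡[] =
    ++⁺ʳ L₂ (↭-sym s) ⨾ ↭-reflexive (++-assoc A D L₂) ⨾ ++⁺ˡ A (swap↭ D L₂)
    ⨾ ++⁺ʳ (L₂ ++ D) (↭-sym ρ₁) ⨾ ↭-reflexive (discard-output≡ L₁ L L₂ D E≡[])

  -- When g discards everything, f ⊕ g applies f ∘ ρ₁ to a copy of L₁ L and keeps L₂.
  module DiscardingOplus {A B Xs Ys D E : List Var} (L₁ L L₂ : List Var)
    (f' : Hθ A D) (g' : Hθ B E) (E≡[] : E ≡ [])
    (σ₁ : Xs ↭ L₁ ++ L ++ L₂) (ρ₁ : L₁ ++ L ↭ A) (ρ₂ : L ++ L₂ ↭ B)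
    (σ₂ : (L₁ ++ L ++ L₂) ++ (D ++ E) ↭ Ys) where

    a = ⟦ L₁ ++ L ⟧₁
    z = ⟦ L₂ ⟧₁
    d = ⟦ D ⟧₁
    F₁ = ⌞ f' ⌟ ∘ rw₀ ρ₁

    input≡ : ⟦ L₁ ++ L ++ L₂ ⟧ ≡ ⟦ L₁ ++ L ⟧ ⊗₀ (⟦ L₂ ⟧ ⊗₀ I)
    input≡ = trans (cong ⟦_⟧ (sym (++-assoc L₁ L L₂)))
      (trans (⟦++⟧ (L₁ ++ L) L₂) (cong (⟦ L₁ ++ L ⟧ ⊗₀_) (sym unitʳ₀)))

    to-σ₂ : HomL (a ++ z ++ d) ⟦ (L₁ ++ L ++ L₂) ++ (D ++ E) ⟧₁
    to-σ₂ = coerceL (sym (trans (cong (λ t → ⟦ t ⟧ ⊗₀ I) (sym (discard-output≡ L₁ L L₂ D E≡[])))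
      (trans (⟦++⟧₁ (L₁ ++ L) (L₂ ++ D)) (cong (⟦ L₁ ++ L ⟧ ⊗₀_) (⟦++⟧₁ L₂ D)))))

    from-σ₁ : HomL ⟦ L₁ ++ L ++ L₂ ⟧₁ (a ++ z)
    from-σ₁ = coerceL (trans (cong (λ t → ⟦ t ⟧ ⊗₀ I) (sym (++-assoc L₁ L L₂))) (⟦++⟧₁ (L₁ ++ L) L₂))

    outputs : HomL (a ++ d ++ z) ⟦ Ys ⟧₁
    outputs = ⟨ rw₀ σ₂ ⟩ · to-σ₂ · (idL a ⊕ σL d z)

    kernel₁ : HomL a (a ++ d)
    kernel₁ = (idL a ⊕ ⟨ F₁ ⟩) · copyL a

    inputs : HomL ⟦ Xs ⟧₁ (a ++ z)
    inputs = from-σ₁ · ⟨ rw₀ σ₁ ⟩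

    normal-form : HomL ⟦ Xs ⟧₁ ⟦ Ys ⟧₁
    normal-form = outputs · (kernel₁ ⊕ idL z) · inputs

    private
      l₁ = ⟦ L₁ ⟧₁
      l = ⟦ L ⟧₁
      F₁' = ⟨ F₁ ⟩ · coerceL {l₁ ++ l} {a} (sym (⟦++⟧₁ L₁ L))

      outputs≅ : rw₀ σ₂ ≅ un (outputs · (idL a ⊕ σL z d))
      outputs≅ = ≅-sym (≅-trans (≡⇒≅ (cong un unswap)) (≅-trans (un· _ _) (absorbʳ (uncoerce _) (un⟨⟩ _))))
        where
          unswap : outputs · (idL a ⊕ σL z d) ≡ ⟨ rw₀ σ₂ ⟩ · to-σ₂
          unswap = trans ·-assoc (trans (cong (⟨ rw₀ σ₂ ⟩ ·_) (trans ·-assoc (cong (to-σ₂ ·_)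
            (trans (id⊕-· (σL d z) (σL z d)) (trans (cong (idL a ⊕_) (σL-involutive z d)) (⊕-id a (z ++ d)))))))
            (cong (⟨ rw₀ σ₂ ⟩ ·_) ·-identityʳ))

      parts≅ : ⌞ (f' ∘θ rw ρ₁) ⊗θ (g' ∘θ rw ρ₂) ⌟ ≅ un (F₁' ⊕ delL (l ++ z))
      parts≅ = ≅-trans (⊗θ≅ (f' ∘θ rw ρ₁) (g' ∘θ rw ρ₂)) (≅-trans (⊗≅
        (≅-sym (≅-trans (un· _ _) (absorbʳ (uncoerce _) (un⟨⟩ F₁))))
        (≅-trans (into-I≅del (⌞ g' ⌟ ∘ rw₀ ρ₂) (cong ⟦_⟧ E≡[]))
                 (≅-trans (del≅ (trans (⟦++⟧ L L₂) (cong (⟦ L ⟧ ⊗₀_) (sym unitʳ₀)))) (≅-sym (undel (l ++ z))))))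
        (≅-sym (un⊕ F₁' (delL (l ++ z)))))

      copy-middle≅ : ⌞ copy-middle L₁ L L₂ ⌟ ≅ un (idL l₁ ⊕ (copyL l ⊕ idL z))
      copy-middle≅ = ≅-trans (castθ≅ refl (++-mid L₁ L L₂) (idθ L₁ ⊗θ (copyθ L ⊗θ idθ L₂)))
        (≅-trans (⊗θ≅ (idθ L₁) (copyθ L ⊗θ idθ L₂))
        (≅-trans (⊗≅ (id≅ (sym unitʳ₀)) (≅-trans (⊗θ≅ (copyθ L) (idθ L₂))
                    (⊗≅ (≅-trans (copyθ≅ L) (copy≅ (sym unitʳ₀))) (id≅ (sym unitʳ₀)))))
        (≅-sym (≅-trans (un⊕ _ _) (⊗≅ (unid l₁) (≅-trans (un⊕ _ _) (⊗≅ (uncopy l) (unid z))))))))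

      middle≅ : (⌞ idθ (L₁ ++ L ++ L₂) ⊗θ ((f' ∘θ rw ρ₁) ⊗θ (g' ∘θ rw ρ₂)) ⌟
                 ∘ ⌞ idθ (L₁ ++ L ++ L₂) ⊗θ copy-middle L₁ L L₂ ⌟)
                ≅ un (idL (a ++ z) ⊕ (⟨ F₁ ⟩ ⊕ delL z))
      middle≅ = ≅-trans (∘≅ (⊗θ≅ (idθ (L₁ ++ L ++ L₂)) ((f' ∘θ rw ρ₁) ⊗θ (g' ∘θ rw ρ₂)))
                               (⊗θ≅ (idθ (L₁ ++ L ++ L₂)) (copy-middle L₁ L L₂))) (≅-trans (≡⇒≅ (sym ⊗-∘))
        (≅-trans (⊗≅ (≅-trans (≡⇒≅ identityˡ) (id≅ input≡))
                     (≅-trans (∘≅ parts≅ copy-middle≅) (≅-trans (≅-sym (un· _ _))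
                       (≅-trans (≡⇒≅ (cong un (discard-copied F₁')))
                         (⊕≅ (≅-trans (un· _ _) (absorbʳ (uncoerce _) ≅-refl)) ≅-refl)))))
                 (≅-sym (≅-trans (un⊕ _ _) (⊗≅ (unid (a ++ z)) ≅-refl)))))

      copy-input≅ : ⌞ copyθ (L₁ ++ L ++ L₂) ⌟ ≅ un (copy²L ⟦ L₁ ++ L ⟧ ⟦ L₂ ⟧)
      copy-input≅ = ≅-trans (copyθ≅ (L₁ ++ L ++ L₂))
        (≅-trans (copy≅ input≡) (≅-trans (≅-sym (uncopy (a ++ z))) (copyL-pair _ _)))

      inputs≅ : rw₀ σ₁ ≅ un inputs
      inputs≅ = ≅-sym (≅-trans (un· _ _) (absorbˡ (uncoerce _) (un⟨⟩ _)))

    ⊕-formula≅normal-form : ⌞ ⊕-formula L₁ L L₂ f' g' σ₁ ρ₁ ρ₂ σ₂ ⌟ ≅ un normal-form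
    ⊕-formula≅normal-form = begin
      ⌞ ⊕-formula L₁ L L₂ f' g' σ₁ ρ₁ ρ₂ σ₂ ⌟
        ≅⟨ ∘≅ outputs≅ (≅-trans (≡⇒≅ (sym assoc)) (∘≅ middle≅ (∘≅ copy-input≅ inputs≅))) ⟩
      un (outputs · (idL a ⊕ σL z d)) ∘ (un (idL (a ++ z) ⊕ (⟨ F₁ ⟩ ⊕ delL z)) ∘ (un (copy²L _ _) ∘ un inputs))
        ≅˘⟨ ·≅ ≅-refl (·≅ ≅-refl (un· _ _)) ⟩
      un ((outputs · (idL a ⊕ σL z d)) · idL (a ++ z) ⊕ (⟨ F₁ ⟩ ⊕ delL z) · copy²L _ _ · inputs)
        ≡⟨ cong un (trans ·-assoc (cong (outputs ·_) (trans (sym ·-assoc) (trans (sym ·-assoc)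
              (cong (_· inputs) (trans ·-assoc (copy²-apply-discard F₁))))))) ⟩
      un normal-form ∎
      where open ≅-Reasoning

    module _ {Y : List Var} (s : A ++ D ↭ Y) where
      f : Hθ A Y
      f = rw s ∘θ (idθ A ⊗θ f') ∘θ copyθ A

      τ₁ : Xs ↭ A ++ L₂
      τ₁ = σ₁ ⨾ ↭-reflexive (sym (++-assoc L₁ L L₂)) ⨾ ++⁺ʳ L₂ ρ₁

      τ₂ : Y ++ L₂ ↭ Ys
      τ₂ = unshuffle L₁ L L₂ s ρ₁ E≡[] ⨾ σ₂

      private
        x = ⟦ A ⟧₁
        kernel : HomL x (x ++ d)
        kernel = (idL x ⊕ ⟨ ⌞ f' ⌟ ⟩) · copyL x
        to-f = coerceL {x ++ d} {⟦ A ++ D ⟧₁} (sym (⟦++⟧₁ A D))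
        from-f = coerceL {⟦ A ++ D ⟧₁ ++ z} {x ++ d ++ z} (trans (cong (_⊗₀ (⟦ L₂ ⟧ ⊗₀ I)) (⟦++⟧ A D)) assoc₀)
        f-image = ⟨ rw₀ s ⟩ · to-f · kernel
        unrewire = from-f · (⟨ rw₀ (↭-sym s) ⟩ ⊕ idL z)
        ρ-image = ⟨ rw₀ ρ₁ ⟩ ⊕ idL z
        unρ = (⟨ rw₀ (↭-sym ρ₁) ⟩ ⊕ idL (z ++ d)) · (idL x ⊕ σL d z)
        τ₂-image = ⟨ rw₀ σ₂ ⟩ · to-σ₂ · unρ · unrewire

        unrewire-f : unrewire · (f-image ⊕ idL z) ≡ kernel ⊕ idL z
        unrewire-f = begin
          (from-f · (⟨ rw₀ (↭-sym s) ⟩ ⊕ idL z)) · (f-image ⊕ idL z)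
            ≡⟨ trans ·-assoc (cong (from-f ·_) (sym ⊕-·)) ⟩
          from-f · ((⟨ rw₀ (↭-sym s) ⟩ · ⟨ rw₀ s ⟩ · to-f · kernel) ⊕ (idL z · idL z))
            ≡⟨ cong (λ t → from-f · (t ⊕ (idL z · idL z))) (trans (sym ·-assoc) (trans (cong (_· (to-f · kernel))
                 (HomL-ext-id (⟨ rw₀ (↭-sym s) ⟩ · ⟨ rw₀ s ⟩) (idL _)
                   (≅-trans (·≅ (un⟨⟩ _) (un⟨⟩ _)) (rw-inverse s)) (unid _))) ·-identityˡ)) ⟩
          from-f · ((to-f · kernel) ⊕ (idL z · idL z))
            ≡⟨ trans (cong (from-f ·_) ⊕-·) (sym ·-assoc) ⟩
          (from-f · (to-f ⊕ idL z)) · (kernel ⊕ idL z)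
            ≡⟨ trans (cong (_· (kernel ⊕ idL z)) (HomL-ext-id (from-f · (to-f ⊕ idL z)) (idL _)
                 (≅-trans (un· _ _) (absorbˡ (uncoerce _)
                   (≅-trans (un⊕ _ _) (≅-trans (⊗≅ (uncoerce _) (unid z)) ⊗-id≅)))) (unid _))) ·-identityˡ ⟩
          kernel ⊕ idL z ∎
          where open ≡-Reasoning

        kernel-ρ : (kernel ⊕ idL z) · ρ-image ≡ ((⟨ rw₀ ρ₁ ⟩ ⊕ idL d) ⊕ idL z) · (kernel₁ ⊕ idL z)
        kernel-ρ = trans (sym ⊕-·) (trans (cong (_⊕ (idL z · idL z)) (begin
          ((idL x ⊕ ⟨ ⌞ f' ⌟ ⟩) · copyL x) · ⟨ rw₀ ρ₁ ⟩
            ≡⟨ trans ·-assoc (cong ((idL x ⊕ ⟨ ⌞ f' ⌟ ⟩) ·_) (copyL-natural (rw₀ ρ₁) (copyNatural-rw ρ₁))) ⟩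
          (idL x ⊕ ⟨ ⌞ f' ⌟ ⟩) · (⟨ rw₀ ρ₁ ⟩ ⊕ ⟨ rw₀ ρ₁ ⟩) · copyL a
            ≡⟨ trans (sym ·-assoc) (cong (_· copyL a) (sym ⊕-·)) ⟩
          ((idL x · ⟨ rw₀ ρ₁ ⟩) ⊕ (⟨ ⌞ f' ⌟ ⟩ · ⟨ rw₀ ρ₁ ⟩)) · copyL a
            ≡⟨ cong (_· copyL a) (cong₂ _⊕_ (trans ·-identityˡ (sym ·-identityʳ))
                                            (trans (⟨⟩-∘ ⌞ f' ⌟ (rw₀ ρ₁)) (sym ·-identityˡ))) ⟩
          ((⟨ rw₀ ρ₁ ⟩ · idL a) ⊕ (idL d · ⟨ F₁ ⟩)) · copyL a
            ≡⟨ trans (cong (_· copyL a) ⊕-·) ·-assoc ⟩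
          (⟨ rw₀ ρ₁ ⟩ ⊕ idL d) · kernel₁ ∎)) ⊕-·)
          where open ≡-Reasoning

        unρ-ρ : unρ · ((⟨ rw₀ ρ₁ ⟩ ⊕ idL d) ⊕ idL z) ≡ idL a ⊕ σL d z
        unρ-ρ = begin
          ((⟨ rw₀ (↭-sym ρ₁) ⟩ ⊕ idL (z ++ d)) · (idL x ⊕ σL d z)) · ((⟨ rw₀ ρ₁ ⟩ ⊕ idL d) ⊕ idL z)
            ≡⟨ trans ·-assoc (cong ((⟨ rw₀ (↭-sym ρ₁) ⟩ ⊕ idL (z ++ d)) ·_)
                 (cong ((idL x ⊕ σL d z) ·_) (trans (HomL-ext (⊕-assoc≅ ⟨ rw₀ ρ₁ ⟩ (idL d) (idL z)))
                                                    (cong (⟨ rw₀ ρ₁ ⟩ ⊕_) (⊕-id d z))))) ⟩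
          (⟨ rw₀ (↭-sym ρ₁) ⟩ ⊕ idL (z ++ d)) · (idL x ⊕ σL d z) · (⟨ rw₀ ρ₁ ⟩ ⊕ idL (d ++ z))
            ≡⟨ cong ((⟨ rw₀ (↭-sym ρ₁) ⟩ ⊕ idL (z ++ d)) ·_) (trans (sym ⊕-·) (trans
                 (cong₂ _⊕_ (trans ·-identityˡ (sym ·-identityʳ)) (trans ·-identityʳ (sym ·-identityˡ))) ⊕-·)) ⟩
          (⟨ rw₀ (↭-sym ρ₁) ⟩ ⊕ idL (z ++ d)) · (⟨ rw₀ ρ₁ ⟩ ⊕ idL (z ++ d)) · (idL a ⊕ σL d z)
            ≡⟨ trans (sym ·-assoc) (cong (_· (idL a ⊕ σL d z)) (trans (sym ⊕-·) (trans (cong₂ _⊕_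
                 (HomL-ext-id (⟨ rw₀ (↭-sym ρ₁) ⟩ · ⟨ rw₀ ρ₁ ⟩) (idL a)
                   (≅-trans (·≅ (un⟨⟩ _) (un⟨⟩ _)) (rw-inverse ρ₁)) (unid _)) ·-identityˡ) (⊕-id a (z ++ d))))) ⟩
          idL (a ++ z ++ d) · (idL a ⊕ σL d z)
            ≡⟨ ·-identityˡ ⟩
          idL a ⊕ σL d z ∎
          where open ≡-Reasoning

        normal-form≡ : normal-form ≡ τ₂-image · (f-image ⊕ idL z) · ρ-image · inputs
        normal-form≡ = begin
          outputs · (kernel₁ ⊕ idL z) · inputs
            ≡⟨ trans ·-assoc (cong (⟨ rw₀ σ₂ ⟩ ·_) (trans ·-assoc (cong (to-σ₂ ·_) (sym ·-assoc)))) ⟩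
          ⟨ rw₀ σ₂ ⟩ · to-σ₂ · ((idL a ⊕ σL d z) · (kernel₁ ⊕ idL z)) · inputs
            ≡⟨ cong (λ t → ⟨ rw₀ σ₂ ⟩ · to-σ₂ · (t · (kernel₁ ⊕ idL z)) · inputs) (sym unρ-ρ) ⟩
          ⟨ rw₀ σ₂ ⟩ · to-σ₂ · ((unρ · ((⟨ rw₀ ρ₁ ⟩ ⊕ idL d) ⊕ idL z)) · (kernel₁ ⊕ idL z)) · inputs
            ≡⟨ cong (λ t → ⟨ rw₀ σ₂ ⟩ · to-σ₂ · t · inputs) (trans ·-assoc (cong (unρ ·_) (sym kernel-ρ))) ⟩
          ⟨ rw₀ σ₂ ⟩ · to-σ₂ · (unρ · (kernel ⊕ idL z) · ρ-image) · inputs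
            ≡⟨ cong (λ t → ⟨ rw₀ σ₂ ⟩ · to-σ₂ · (unρ · t · ρ-image) · inputs) (sym unrewire-f) ⟩
          ⟨ rw₀ σ₂ ⟩ · to-σ₂ · (unρ · (unrewire · (f-image ⊕ idL z)) · ρ-image) · inputs
            ≡⟨ cong (⟨ rw₀ σ₂ ⟩ ·_) (trans (cong (to-σ₂ ·_) (trans ·-assoc
                 (trans (cong (unρ ·_) (trans ·-assoc ·-assoc)) (sym ·-assoc)))) (sym ·-assoc)) ⟩
          ⟨ rw₀ σ₂ ⟩ · ((to-σ₂ · unρ · unrewire) · (f-image ⊕ idL z) · ρ-image · inputs)
            ≡⟨ sym ·-assoc ⟩
          τ₂-image · (f-image ⊕ idL z) · ρ-image · inputs ∎
          where open ≡-Reasoning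

        τ₂≅ : rw₀ τ₂ ≅ un τ₂-image
        τ₂≅ = ≅-sym (·≅ (un⟨⟩ _) (≅-trans (un· _ _) (absorbˡ (uncoerce _) (≅-sym
          (absorbˡ (rw-reflexive (discard-output≡ L₁ L L₂ D E≡[])) (≅-trans (≡⇒≅ (sym assoc)) (≅-trans
            (∘≅ (∘≅ unρ₁≅ swap≅) (absorbˡ (rw-reflexive (++-assoc A D L₂))
                                     (≅-trans unrewire-s≅ (≅-sym (absorbˡ (uncoerce _) ≅-refl)))))
            (≅-sym (·≅ (un· _ _) (un· _ _))))))))))
          where
            unρ₁≅ : rw₀ (++⁺ʳ (L₂ ++ D) (↭-sym ρ₁)) ≅ un (⟨ rw₀ (↭-sym ρ₁) ⟩ ⊕ idL (z ++ d))
            unρ₁≅ = ≅-trans (rw-++⁺ʳ (L₂ ++ D) (↭-sym ρ₁)) (≅-sym (≅-trans (un⊕ _ _) (⊗≅ (un⟨⟩ _)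
              (≅-trans (unid (z ++ d)) (id≅ (trans (cong (⟦ L₂ ⟧ ⊗₀_) unitʳ₀) (sym (⟦++⟧ L₂ D))))))))
            swap≅ : rw₀ (++⁺ˡ A (swap↭ D L₂)) ≅ un (idL x ⊕ σL d z)
            swap≅ = ≅-trans (rw-++⁺ˡ A (swap↭ D L₂)) (≅-trans (⊗≅ ≅-refl (rw-swap D L₂))
              (≅-sym (≅-trans (un⊕ _ _) (⊗≅ (≅-trans (unid x) (id≅ unitʳ₀)) (≅-trans (unσ d z) (σ≅ unitʳ₀ unitʳ₀))))))
            unrewire-s≅ : rw₀ (++⁺ʳ L₂ (↭-sym s)) ≅ un (⟨ rw₀ (↭-sym s) ⟩ ⊕ idL z)
            unrewire-s≅ = ≅-trans (rw-++⁺ʳ L₂ (↭-sym s))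
              (≅-sym (≅-trans (un⊕ _ _) (⊗≅ (un⟨⟩ _) (≅-trans (unid z) (id≅ unitʳ₀)))))

        f⊗id≅ : ⌞ f ⊗θ idθ L₂ ⌟ ≅ un (f-image ⊕ idL z)
        f⊗id≅ = ≅-trans (⊗θ≅ f (idθ L₂))
          (≅-sym (≅-trans (un⊕ _ _) (⊗≅ (≅-sym (kernel≅ f' s)) (≅-trans (unid z) (id≅ unitʳ₀)))))

        τ₁≅ : rw₀ τ₁ ≅ un (ρ-image · inputs)
        τ₁≅ = ≅-sym (·≅ (≅-trans (un⊕ _ _)
                          (≅-trans (⊗≅ (un⟨⟩ _) (≅-trans (unid z) (id≅ unitʳ₀))) (≅-sym (rw-++⁺ʳ L₂ ρ₁))))
          (≅-sym (absorbˡ (rw-reflexive (sym (++-assoc L₁ L L₂))) inputs≅)))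

      discarding-⊕≅⊗id : ⌞ ⊕-formula L₁ L L₂ f' g' σ₁ ρ₁ ρ₂ σ₂ ⌟ ≅ ⌞ rw τ₂ ∘θ (f ⊗θ idθ L₂) ∘θ rw τ₁ ⌟
      discarding-⊕≅⊗id = ≅-trans ⊕-formula≅normal-form (≅-trans (≡⇒≅ (cong un normal-form≡))
        (·≅ (≅-sym τ₂≅) (·≅ (≅-sym f⊗id≅) (≅-sym τ₁≅))))

module Subkernels {o ℓ : Level} (V : VarStructure) (C : StrictMarkov o ℓ)
                  (θ : VarStructure.Var V → StrictMarkov.Obj C) where
  open Theory V C θ
  open Markov C
  open Rewirings V C θ
  open IsStrictTotalOrder isSTO using (compare; _≟_; irrefl) renaming (trans to ≺-trans)
  open DecMembership _≟_ using (_∈?_)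
  open All.All using ([]; _∷_)
  open Linked.Linked using ([-]; _∷_)

  ∩-disjoint : ∀ {A B : List Var} → (∀ x → x ∈ A → x ∉ B) → A ∩ B ≡ []
  ∩-disjoint {A} {B} h = filter-none (λ x → x ∈? B) (All.tabulate (λ {x} x∈A → h x x∈A))

  ∖-disjoint : ∀ {A B : List Var} → (∀ x → x ∈ A → x ∉ B) → A ∖ B ≡ A
  ∖-disjoint {A} {B} h = filter-all (λ x → ¬? (x ∈? B)) (All.tabulate (λ {x} x∈A → h x x∈A))

  ∖-self : ∀ (A : List Var) → A ∖ A ≡ []
  ∖-self A = filter-none (λ x → ¬? (x ∈? A)) (All.tabulate (λ x∈A x∉A → x∉A x∈A))

  ∖-cong : ∀ (B A A' : List Var) → (∀ b → b ∈ B → (b ∈ A → b ∈ A') × (b ∈ A' → b ∈ A)) → B ∖ A ≡ B ∖ A'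
  ∖-cong [] A A' h = refl
  ∖-cong (b ∷ B) A A' h with b ∈? A | b ∈? A'
  ... | yes p | yes q = ∖-cong B A A' (λ c c∈ → h c (there c∈))
  ... | no p  | no q  = cong (b ∷_) (∖-cong B A A' (λ c c∈ → h c (there c∈)))
  ... | yes p | no q  = ⊥-elim (q (proj₁ (h b (here refl)) p))
  ... | no p  | yes q = ⊥-elim (p (proj₂ (h b (here refl)) q))

  private
    below-head : ∀ {x y ys} → x ≺ y → Sorted (y ∷ ys) → All (x ≺_) (y ∷ ys)
    below-head x<y [-] = x<y ∷ []
    below-head x<y (r ∷ rs) = Linked.Linked⇒All ≺-trans x<y (r ∷ rs)

    below-tail : ∀ {y ys} → Sorted (y ∷ ys) → All (y ≺_) ys
    below-tail [-] = []
    below-tail (r ∷ rs) = Linked.Linked⇒All ≺-trans r rs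

    below⇒∉ : ∀ {x W} → All (x ≺_) W → x ∉ W
    below⇒∉ (px ∷ _) (here refl) = irrefl refl px
    below⇒∉ (_ ∷ pxs) (there m) = below⇒∉ pxs m

    ∖-∉ : ∀ {y} (ys A : List Var) → y ∉ A → (y ∷ ys) ∖ A ≡ y ∷ (ys ∖ A)
    ∖-∉ {y} ys A y∉A with y ∈? A
    ... | yes i = ⊥-elim (y∉A i)
    ... | no _ = refl

    ∖-∈ : ∀ {y} (ys A : List Var) → y ∈ A → (y ∷ ys) ∖ A ≡ ys ∖ A
    ∖-∈ {y} ys A y∈A with y ∈? A
    ... | yes _ = refl
    ... | no y∉A = ⊥-elim (y∉A y∈A)

    ∖-∷-drop : ∀ x xs B → All (x ≺_) B → B ∖ (x ∷ xs) ≡ B ∖ xs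
    ∖-∷-drop x xs B x<B = ∖-cong B (x ∷ xs) xs (λ b b∈B →
      (λ { (here refl) → ⊥-elim (below⇒∉ x<B b∈B) ; (there m) → m }) , there)

    ∪-identityʳ : ∀ (xs : List Var) → xs ∪ [] ≡ xs
    ∪-identityʳ [] = refl
    ∪-identityʳ (x ∷ xs) = refl

    ∪-head< : ∀ {x} (xs W : List Var) → All (x ≺_) W → (x ∷ xs) ∪ W ≡ x ∷ (xs ∪ W)
    ∪-head< xs [] _ = cong (_ ∷_) (sym (∪-identityʳ xs))
    ∪-head< {x} xs (w ∷ W) (x<w ∷ _) with compare x w
    ... | tri< _ _ _ = refl
    ... | tri≈ n _ _ = ⊥-elim (n x<w)
    ... | tri> n _ _ = ⊥-elim (n x<w)

    ∪-head> : ∀ {x y} (xs ys : List Var) → y ≺ x → (x ∷ xs) ∪ (y ∷ ys) ≡ y ∷ ((x ∷ xs) ∪ ys)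
    ∪-head> {x} {y} xs ys y<x with compare x y
    ... | tri< _ _ n = ⊥-elim (n y<x)
    ... | tri≈ _ _ n = ⊥-elim (n y<x)
    ... | tri> _ _ _ = refl

  ∪-∖ : ∀ (A B : List Var) → Sorted A → Sorted B → A ∪ (B ∖ A) ≡ A ∪ B
  ∪-∖ [] B sA sB = ∖-disjoint (λ _ _ ())
  ∪-∖ (x ∷ xs) B sA sB = go B sB
    where
      go : ∀ B → Sorted B → (x ∷ xs) ∪ (B ∖ (x ∷ xs)) ≡ (x ∷ xs) ∪ B
      go [] sB = refl
      go (y ∷ ys) sB with compare x y
      ... | tri< x<y _ _ =
        trans (cong ((x ∷ xs) ∪_) (∖-∷-drop x xs (y ∷ ys) (below-head x<y sB)))
        (trans (∪-head< xs ((y ∷ ys) ∖ xs) (All.filter⁺ (λ v → ¬? (v ∈? xs)) (below-head x<y sB)))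
               (cong (x ∷_) (∪-∖ xs (y ∷ ys) (Linked.tail sA) sB)))
      ... | tri≈ _ refl _ =
        trans (cong ((x ∷ xs) ∪_) (trans (∖-∈ ys (x ∷ xs) (here refl)) (∖-∷-drop x xs ys (below-tail sB))))
        (trans (∪-head< xs (ys ∖ xs) (All.filter⁺ (λ v → ¬? (v ∈? xs)) (below-tail sB)))
               (cong (x ∷_) (∪-∖ xs ys (Linked.tail sA) (Linked.tail sB))))
      ... | tri> _ _ y<x =
        trans (cong ((x ∷ xs) ∪_) (∖-∉ ys (x ∷ xs) (below⇒∉ (below-head y<x sA))))
        (trans (∪-head> xs (ys ∖ (x ∷ xs)) y<x) (cong (y ∷_) (go ys (Linked.tail sB))))

  discard-part : ∀ Z → Σ (Hθ Z (Z ∖ Z)) (IsNontrivialPart (idθ Z))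
  discard-part Z = ⌜ subst₂ Hom refl (cong ⟦_⟧ (sym (∖-self Z))) del ⌝ , ↭-reflexive Z++[]≡Z ,
    cong ⌜_⌝ (≅⇒≡ (≅-sym (absorbˡ (rw-reflexive Z++[]≡Z)
      (≅-trans (∘≅ (≅-trans (⊗θ≅ (idθ Z) _) (⊗≅ ≅-refl (subst₂≅ _ _ _))) (copyθ≅ Z)) counitʳ≅))))
    where
      Z++[]≡Z : Z ++ (Z ∖ Z) ≡ Z
      Z++[]≡Z = trans (cong (Z ++_) (∖-self Z)) (++-identityʳ Z)

  ⊗id-isOplus : ∀ {X Y Z : List Var} (f : Kernel X Y) → (∀ z → z ∈ Z → z ∉ Y) →
                (σ₁ : X ∪ Z ↭ X ++ Z) (σ₂ : Y ++ Z ↭ Y ∪ Z) →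
                IsOplus (proj₁ f) (idθ Z) (rw σ₂ ∘θ (proj₁ f ⊗θ idθ Z) ∘θ rw σ₁)
  ⊗id-isOplus {X} {Y} {Z} (fm , _ , _ , X⊆Y , f' , s , fm≡) Z∩Y=∅ σ₁ σ₂ =
    trans X∩Z≡[] (sym (∩-disjoint (λ y y∈Y y∈Z → Z∩Y=∅ y y∈Z y∈Y))) ,
    f' , (s , fm≡) , g' , g'-part , σ₁' , ρ₁ , ρ₂ , σ₂' ,
    cong ⌜_⌝ (≅⇒≡ (≅-sym (≅-trans (discarding-⊕≅⊗id s) (∘≅ τ₂≅σ₂ (∘≅ f⊗id≅ τ₁≅σ₁)))))
    where
      X∩Z=∅ : ∀ x → x ∈ X → x ∉ Z
      X∩Z=∅ x x∈X x∈Z = Z∩Y=∅ x x∈Z (X⊆Y x∈X)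
      X∩Z≡[] : X ∩ Z ≡ []
      X∩Z≡[] = ∩-disjoint X∩Z=∅
      X∖Z≡X : X ∖ Z ≡ X
      X∖Z≡X = ∖-disjoint X∩Z=∅
      Z∖X≡Z : Z ∖ X ≡ Z
      Z∖X≡Z = ∖-disjoint (λ z z∈Z z∈X → X∩Z=∅ z z∈X z∈Z)
      g' = proj₁ (discard-part Z)
      g'-part = proj₂ (discard-part Z)
      split≡ : (X ∖ Z) ++ (X ∩ Z) ++ (Z ∖ X) ≡ X ++ Z
      split≡ = cong₂ _++_ X∖Z≡X (cong₂ _++_ X∩Z≡[] Z∖X≡Z)
      L₁L≡X : (X ∖ Z) ++ (X ∩ Z) ≡ X
      L₁L≡X = trans (cong₂ _++_ X∖Z≡X X∩Z≡[]) (++-identityʳ X)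
      σ₁' = σ₁ ⨾ ↭-reflexive (sym split≡)
      ρ₁ = ↭-reflexive L₁L≡X
      ρ₂ = ↭-reflexive (cong₂ _++_ X∩Z≡[] Z∖X≡Z)
      -- σ₂' first undoes the rewiring that discarding-⊕≅⊗id puts in front of it.
      unshuffled = unshuffle (X ∖ Z) (X ∩ Z) (Z ∖ X) s ρ₁ (∖-self Z)
      σ₂' = ↭-sym unshuffled ⨾ ↭-reflexive (cong (Y ++_) Z∖X≡Z) ⨾ σ₂
      open DiscardingOplus (X ∖ Z) (X ∩ Z) (Z ∖ X) f' g' (∖-self Z) σ₁' ρ₁ ρ₂ σ₂'
      τ₂≅σ₂ : rw₀ (τ₂ s) ≅ rw₀ σ₂
      τ₂≅σ₂ = ≅-trans (≡⇒≅ assoc) (absorbʳ (≅-trans (≡⇒≅ assoc)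
        (absorbˡ (rw-reflexive (cong (Y ++_) Z∖X≡Z)) (rw-inverse unshuffled))) ≅-refl)
      f⊗id≅ : ⌞ f s ⊗θ idθ (Z ∖ X) ⌟ ≅ ⌞ fm ⊗θ idθ Z ⌟
      f⊗id≅ = ≅-trans (⊗θ≅ (f s) (idθ (Z ∖ X))) (≅-trans (⊗≅ (≡⇒≅ (cong ⌞_⌟ (sym fm≡))) (id≅ (cong ⟦_⟧ Z∖X≡Z)))
        (≅-sym (⊗θ≅ fm (idθ Z))))
      τ₁≅σ₁ : rw₀ (τ₁ s) ≅ rw₀ σ₁
      τ₁≅σ₁ = absorbˡ (≅-trans (rw-++⁺ʳ (Z ∖ X) ρ₁) (≅-trans (⊗≅ (rw-reflexive L₁L≡X) ≅-refl) ⊗-id≅))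
        (absorbˡ (rw-reflexive (sym (++-assoc (X ∖ Z) (X ∩ Z) (Z ∖ X)))) (absorbˡ (rw-reflexive (sym split≡)) ≅-refl))

  ⊕id-as-⊗id : ∀ {X Y U : List Var} (f : Kernel X Y) (k : Hθ (X ∪ U) (Y ∪ U)) → IsOplus (proj₁ f) (idθ U) k →
               Σ (X ∪ U ↭ X ++ (U ∖ X)) λ τ₁ → Σ (Y ++ (U ∖ X) ↭ Y ∪ U) λ τ₂ →
                 k ≡ rw τ₂ ∘θ (proj₁ f ⊗θ idθ (U ∖ X)) ∘θ rw τ₁
  ⊕id-as-⊗id {X} {Y} {U} (fm , _) k (_ , f' , (s , fm≡) , g' , _ , σ₁ , ρ₁ , ρ₂ , σ₂ , k≡) =
    τ₁ s , τ₂ s , trans k≡ (cong ⌜_⌝ (≅⇒≡ (≅-trans (discarding-⊕≅⊗id s)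
      (≡⇒≅ (cong (λ t → ⌞ rw (τ₂ s) ∘θ (t ⊗θ idθ (U ∖ X)) ∘θ rw (τ₁ s) ⌟) (sym fm≡))))))
    where open DiscardingOplus (X ∖ U) (X ∩ U) (U ∖ X) f' g' (∖-self U) σ₁ ρ₁ ρ₂ σ₂

  ⊕id-Factorisation : ∀ {X Y X' Y' : List Var} → Kernel X Y → Kernel X' Y' → Set ℓ
  ⊕id-Factorisation {X} {Y} {X'} {Y'} f g =
    Σ (List Var) λ U → Sorted U ×
    Σ (Hθ (X ∪ U) (Y ∪ U)) λ k → IsOplus (proj₁ f) (idθ U) k ×
    Σ (Kernel (Y ∪ U) Y') λ h →
    Σ (X ∪ U ≡ X') λ e →
      proj₁ g ≡ castθ e refl (proj₁ h ∘θ k)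

  ⊑⇒⊕id-factorisation : ∀ {X Y X' Y'} (f : Kernel X Y) (g : Kernel X' Y') → f ⊑ g → ⊕id-Factorisation f g
  ⊑⇒⊕id-factorisation f g (Z , sZ , Z∩Y=∅ , e , h , σ₁ , σ₂ , g≡) =
    Z , sZ , _ , ⊗id-isOplus f Z∩Y=∅ σ₁ σ₂ , h , e , g≡

  ⊑-intro : ∀ {X Y X' Y' XZ YZ} (f : Kernel X Y) (g : Kernel X' Y') (Z : List Var) → Sorted Z →
            (∀ z → z ∈ Z → z ∉ Y) → X ∪ Z ≡ XZ → Y ∪ Z ≡ YZ → (e : XZ ≡ X') (h : Kernel YZ Y')
            (τ₁ : XZ ↭ X ++ Z) (τ₂ : Y ++ Z ↭ YZ) →
            proj₁ g ≡ castθ e refl (proj₁ h ∘θ rw τ₂ ∘θ (proj₁ f ⊗θ idθ Z) ∘θ rw τ₁) → f ⊑ g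
  ⊑-intro f g Z sZ Z∩Y=∅ refl refl e h τ₁ τ₂ g≡ = Z , sZ , Z∩Y=∅ , e , h , τ₁ , τ₂ , g≡

  ⊕id-factorisation⇒⊑ : ∀ {X Y X' Y'} (f : Kernel X Y) (g : Kernel X' Y') → ⊕id-Factorisation f g → f ⊑ g
  ⊕id-factorisation⇒⊑ {X} {Y} f g (U , sU , k , k-oplus , h , e , g≡) =
    ⊑-intro f g (U ∖ X) (Linked.filter⁺ (λ x → ¬? (x ∈? X)) ≺-trans sU) U∖X∩Y=∅
      (∪-∖ X U sX sU) (trans (cong (Y ∪_) (∖-cong U X Y (λ u u∈U → X⊆Y , U∩Y⊆X u u∈U))) (∪-∖ Y U sY sU))
      e h τ₁ τ₂ (trans g≡ (cong (λ t → castθ e refl (proj₁ h ∘θ t)) k≡))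
    where
      sX = proj₁ (proj₂ f)
      sY = proj₁ (proj₂ (proj₂ f))
      X⊆Y = proj₁ (proj₂ (proj₂ (proj₂ f)))
      factor = ⊕id-as-⊗id f k k-oplus
      τ₁ = proj₁ factor
      τ₂ = proj₁ (proj₂ factor)
      k≡ = proj₂ (proj₂ factor)
      U∩Y⊆X : ∀ u → u ∈ U → u ∈ Y → u ∈ X
      U∩Y⊆X u u∈U u∈Y = proj₁ (∈-filter⁻ (λ x → x ∈? U) {xs = X}
        (subst (u ∈_) (sym (proj₁ k-oplus)) (∈-filter⁺ (λ x → x ∈? U) u∈Y u∈U)))
      U∖X∩Y=∅ : ∀ z → z ∈ U ∖ X → z ∉ Y
      U∖X∩Y=∅ z z∈ z∈Y = let (z∈U , z∉X) = ∈-filter⁻ (λ x → ¬? (x ∈? X)) {xs = U} z∈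
                          in z∉X (U∩Y⊆X z z∈U z∈Y)

  ⊑⇔⊕id-factorisation : ∀ {X Y X' Y'} (f : Kernel X Y) (g : Kernel X' Y') → (f ⊑ g) ⇔ ⊕id-Factorisation f g
  ⊑⇔⊕id-factorisation f g = mk⇔ (⊑⇒⊕id-factorisation f g) (⊕id-factorisation⇒⊑ f g)

lemma2 : ∀ {o ℓ : Level} (V : VarStructure) (C : StrictMarkov o ℓ)
    (θ : VarStructure.Var V → StrictMarkov.Obj C) →
    let open Theory V C θ in
    ∀ {X Y X' Y' : List Var} (f : Kernel X Y) (g : Kernel X' Y') →
    (f ⊑ g) ⇔
    (Σ (List Var) λ U → Sorted U ×
    Σ (Hθ (X ∪ U) (Y ∪ U)) λ k → IsOplus (proj₁ f) (idθ U) k ×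
    Σ (Kernel (Y ∪ U) Y') λ h →
    Σ (X ∪ U ≡ X') λ e →
    proj₁ g ≡ castθ e refl (proj₁ h ∘θ k))
lemma2 V C θ = Subkernels.⊑⇔⊕id-factorisation V C θ
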